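{- Let $c$ be an even positive integer, $0\le k\le n$ and $\sigma\in D_k^{(c)}$. Then $$\sum_{\substack{\pi\in G_{c,n}\\ dp(\pi)=\sigma}} (-1)^{L(\pi)}q^{fmaj(\pi)}=(-1)^{L(\sigma)}q^{fmaj(\sigma)}{n \brack k}_{q^c}.$$
   Context: For positive integers $c,n$, $G_{c,n}$ is the set of colored permutations $\pi=\pi_1^{[t_1]}\cdots\pi_n^{[t_n]}$ with $|\pi|=\pi_1\cdots\pi_n$ a permutation of $[n]$ and colors $t_i\in\{0,\dots,c-1\}$; $col(\pi)=\sum_it_i$; $inv(\sigma)$ is the number of pairs $i<j$ with $\sigma_i>\sigma_j$. The length is $L(\pi)=col(\pi)+c\sum_{j:t_j\ne0}|\{i<j:\pi_i<\pi_j\}|+inv(|\pi|)$ (for $\sigma\in G_{c,k}$ computed with $k$ in place of $n$). A fixed point of $\pi$ is an index $i$ with $\pi_i=i$ and $t_i=0$; $D_k^{(c)}\subseteq G_{c,k}$ is the set of elements with no fixed point ($D_0^{(c)}$ = the empty word, with $L=fmaj=0$). The derangement part $dp(\pi)$: with $j_1<\dots<j_k$ the non-fixed positions and $a_1<\dots<a_k$ the values $\{\pi_{j_1},\dots,\pi_{j_k}\}$, $dp(\pi)\in D_k^{(c)}$ is the subword $\pi_{j_1}^{[t_{j_1}]}\cdots\pi_{j_k}^{[t_{j_k}]}$ with each $a_i^{[r]}$ replaced by $i^{[r]}$. Order colored letters by $1^{[c-1]}<\cdots<n^{[c-1]}<\cdots<1^{[1]}<\cdots<n^{[1]}<1<\cdots<n$;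 $Des_c(\pi)=\{i:\pi_i^{[t_i]}>\pi_{i+1}^{[t_{i+1}]}\}$, $maj(\pi)=\sum_{i\in Des_c(\pi)}i$, $fmaj(\pi)=c\cdot maj(\pi)+col(\pi)$. $[m]_x=1+x+\cdots+x^{m-1}$, $[m]_x!=\prod_{i=1}^m[i]_x$, ${n \brack k}_x=\frac{[n]_x!}{[k]_x![n-k]_x!}$. -}

module Defs where

open import Data.Nat using (ℕ; zero; suc; _+_; _*_; _∸_; _<ᵇ_; _≡ᵇ_)
open import Data.Nat.Properties using () renaming (_≟_ to _≟ℕ_)
open import Data.Bool using (Bool; true; false; if_then_else_; not; _∧_; _∨_)
open import Data.List using (List; []; _∷_; map; concatMap; filter; filterᵇ; length; upTo; foldr; _++_)
open import Data.Bool.ListAction using (all; any)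
open import Data.Nat.ListAction using (sum)
import Data.List.Properties as LP
import Data.Product.Properties as PP
open import Data.Product using (_×_; _,_; proj₁; proj₂)
open import Data.Integer using (ℤ; +_; -_) renaming (_*_ to _*ℤ_; _+_ to _+ℤ_; _^_ to _^ℤ_)
open import Relation.Binary.PropositionalEquality using (_≡_)
open import Relation.Binary.Definitions using (DecidableEquality)

-- A colored letter  v^[t]  is the pair (v , t); a colored word is a list of
-- colored letters; positions are 1-indexed (position of the head is 1).
Letter : Set
Letter = ℕ × ℕ

Word : Set
Word = List Letter

_≟W_ : DecidableEquality Word
_≟W_ = LP.≡-dec (PP.≡-dec _≟ℕ_ _≟ℕ_)

allWords : {A : Set} → ℕ → List A → List (List A)
allWords zero    xs = [] ∷ []
allWords (suc m) xs = concatMap (λ x → map (x ∷_) (allWords m xs)) xs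

letters : ℕ → ℕ → List Letter
letters c n = concatMap (λ v → map (λ t → (suc v , t)) (upTo c)) (upTo n)

distinctVals : Word → Bool
distinctVals []             = true
distinctVals ((v , _) ∷ w)  = all (λ l → not (proj₁ l ≡ᵇ v)) w ∧ distinctVals w

G : ℕ → ℕ → List Word
G c n = filterᵇ distinctVals (allWords n (letters c n))

indexFrom : ℕ → Word → List (ℕ × Letter)
indexFrom i []      = []
indexFrom i (x ∷ w) = (i , x) ∷ indexFrom (suc i) w

indexed : Word → List (ℕ × Letter)
indexed = indexFrom 1

isFixed : ℕ × Letter → Bool
isFixed (i , (v , t)) = (v ≡ᵇ i) ∧ (t ≡ᵇ 0)

hasFixedPoint : Word → Bool
hasFixedPoint w = any isFixed (indexed w)

D : ℕ → ℕ → List Word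
D c k = filterᵇ (λ w → not (hasFixedPoint w)) (G c k)

count : {A : Set} → (A → Bool) → List A → ℕ
count p xs = length (filterᵇ p xs)

col : Word → ℕ
col w = sum (map proj₂ w)

inv : Word → ℕ
inv []            = 0
inv ((v , _) ∷ w) = count (λ l → proj₁ l <ᵇ v) w + inv w

-- Σ_{j : t_j ≠ 0} |{ i < j : π_i < π_j }|   (computed over the prefix before j)
colAsc : Word → Word → ℕ
colAsc pre []             = 0
colAsc pre ((v , t) ∷ w)  =
  (if t ≡ᵇ 0 then 0 else count (λ l → proj₁ l <ᵇ v) pre) + colAsc (pre ++ ((v , t) ∷ [])) w

L : ℕ → Word → ℕ
L c w = col w + c * colAsc [] w + inv w

dp : Word → Word
dp w = map (λ l → (suc (count (λ m → proj₁ m <ᵇ proj₁ l) kept) , proj₂ l)) kept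
  where
  kept : Word
  kept = map proj₂ (filterᵇ (λ p → not (isFixed p)) (indexed w))

-- order on colored letters: 1^[c-1] < … < n^[c-1] < … < 1^[1] < … < n^[1] < 1 < … < n,
-- i.e. (a , r) < (b , s) iff r > s, or r = s and a < b
_<L_ : Letter → Letter → Bool
(a , r) <L (b , s) = (s <ᵇ r) ∨ ((r ≡ᵇ s) ∧ (a <ᵇ b))

majFrom : ℕ → Word → ℕ
majFrom i []            = 0
majFrom i (x ∷ [])      = 0
majFrom i (x ∷ y ∷ w)   = (if y <L x then i else 0) + majFrom (suc i) (y ∷ w)

maj : Word → ℕ
maj = majFrom 1

fmaj : ℕ → Word → ℕ
fmaj c w = c * maj w + col w

signedSum : ℕ → ℤ → List Word → ℤ
signedSum c q ws = foldr (λ π acc → ((- (+ 1)) ^ℤ L c π) *ℤ (q ^ℤ fmaj c π) +ℤ acc) (+ 0) ws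

qInt : ℤ → ℕ → ℤ
qInt x m = foldr (λ i acc → (x ^ℤ i) +ℤ acc) (+ 0) (upTo m)

qFact : ℤ → ℕ → ℤ
qFact x zero    = + 1
qFact x (suc m) = qFact x m *ℤ qInt x (suc m)

withDp : ℕ → ℕ → Word → List Word
withDp c n σ = filter (λ π → dp π ≟W σ) (G c n)

-- Inserting fixed points into σ according to a word bs with n - k entries true (the fixed
-- positions) and k entries false gives exactly the π with dp π = σ.  Insertion keeps col, and it
-- changes inv by an even amount, since a fixed point has as many larger letters before it as
-- smaller letters after it; as c is even, every such π then has the sign (-1)^{L σ}, and the sum
-- becomes (-1)^{L σ} q^{col σ} Σ x^{maj π} with x = q^c.  A fixed point compares with a
-- neighbouring letter of σ according to whether that letter lies above or below its position in σ,
-- so maj π is computed on σ's letters, their positions and bs alone.  Building bs from the right,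
-- the two generating functions according to the kind of the rightmost cell obey the Pascal
-- recurrences of the Gaussian binomial, and Σ x^{maj π} = x^{maj σ} [n choose k]_x.

module Submission where

open import Defs
open import Relation.Binary.PropositionalEquality
open import Data.Nat using (ℕ; zero; suc; _+_; _*_; _∸_; _≤_; _<_; z≤n; s≤s; _<ᵇ_; _≡ᵇ_; pred)
import Data.Nat.Properties as NP
open import Data.Nat.Divisibility using (_∣_; divides)
open import Data.Nat.ListAction using (sum)
open import Data.Nat.Tactic.RingSolver using () renaming (solve-∀ to ℕ-solve-∀)
open import Data.Bool using (Bool; true; false; if_then_else_; not; _∧_; _∨_; T)
open import Data.Bool.ListAction using (all; any)
open import Data.Integer using (ℤ; +_; -_) renaming (_*_ to _*ℤ_; _+_ to _+ℤ_; _^_ to _^ℤ_)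
import Data.Integer.Properties as ZP
open import Data.Integer.Tactic.RingSolver using (solve-∀)
open import Data.Product using (_×_; _,_; proj₁; proj₂; Σ; map₁; map₂)
open import Data.Sum using (_⊎_; inj₁; inj₂)
open import Data.Unit using (⊤; tt)
open import Data.Empty using (⊥; ⊥-elim)
open import Data.List using (List; []; _∷_; map; length; upTo; foldr; _++_; _∷ʳ_; drop; reverse; filterᵇ; concatMap; cartesianProductWith)
import Data.List.Properties as LP
open import Data.List.Relation.Unary.All using (All; []; _∷_)
import Data.List.Relation.Unary.All as All
import Data.List.Relation.Unary.All.Properties as AllP
open import Data.List.Relation.Unary.AllPairs using ([]; _∷_)
open import Data.List.Relation.Unary.Any using (here; there)
open import Data.List.Relation.Unary.Unique.Propositional using (Unique)
import Data.List.Relation.Unary.Unique.Propositional.Properties as UP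
open import Data.List.Membership.Propositional using (_∈_)
import Data.List.Membership.Propositional.Properties as MP
open import Data.List.Membership.Propositional.Properties.WithK using (unique∧set⇒bag)
open import Data.List.Membership.DecPropositional NP._≟_ using (_∈?_)
open import Data.List.Relation.Binary.Permutation.Propositional
  using (_↭_; ↭-sym; ↭-trans; ↭-refl; ↭-prep; ↭⇒↭ₛ; module PermutationReasoning)
import Data.List.Relation.Binary.Permutation.Propositional.Properties as PP
open import Data.List.Relation.Binary.Permutation.Setoid.Properties (setoid ℤ) using (foldr-commMonoid)
open import Data.List.Relation.Binary.Permutation.Setoid.Properties (setoid ℕ) using () renaming (Unique-resp-↭ to Unique-resp-↭ₛ)
open import Data.List.Relation.Binary.BagAndSetEquality using (∼bag⇒↭)
open import Algebra.Properties.CommutativeSemigroup NP.+-commutativeSemigroup using (x∙yz≈y∙xz; xy∙z≈y∙xz; interchange)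
open import Function using (_∘_; case_of_)
open import Function.Bundles using (mk⇔)
open import Relation.Binary.Definitions using (tri<; tri≈; tri>)
open import Relation.Nullary using (¬_; yes; no)
open import Relation.Nullary.Decidable using (T?)

-- Sums and Gaussian binomials

sumℤ : List ℤ → ℤ
sumℤ = foldr _+ℤ_ (+ 0)

sumℤ-++ : ∀ xs ys → sumℤ (xs ++ ys) ≡ sumℤ xs +ℤ sumℤ ys
sumℤ-++ []       ys = sym (ZP.+-identityˡ _)
sumℤ-++ (x ∷ xs) ys = trans (cong (x +ℤ_) (sumℤ-++ xs ys)) (sym (ZP.+-assoc x _ _))

sumℤ-map-cong : {A : Set} {f g : A → ℤ} (xs : List A) →
  (∀ {x} → x ∈ xs → f x ≡ g x) → sumℤ (map f xs) ≡ sumℤ (map g xs)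
sumℤ-map-cong []       f≗g = refl
sumℤ-map-cong (x ∷ xs) f≗g = cong₂ _+ℤ_ (f≗g (here refl)) (sumℤ-map-cong xs (f≗g ∘ there))

sumℤ-map-*ˡ : {A : Set} (c : ℤ) (f : A → ℤ) (xs : List A) →
  sumℤ (map (λ a → c *ℤ f a) xs) ≡ c *ℤ sumℤ (map f xs)
sumℤ-map-*ˡ c f []       = sym (ZP.*-zeroʳ c)
sumℤ-map-*ˡ c f (x ∷ xs) =
  trans (cong (c *ℤ f x +ℤ_) (sumℤ-map-*ˡ c f xs)) (sym (ZP.*-distribˡ-+ c (f x) _))

sumℤ-↭ : {xs ys : List ℤ} → xs ↭ ys → sumℤ xs ≡ sumℤ ys
sumℤ-↭ = foldr-commMonoid ZP.+-0-isCommutativeMonoid ∘ ↭⇒↭ₛ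

qInt-suc : ∀ x m → qInt x (suc m) ≡ qInt x m +ℤ x ^ℤ m
qInt-suc x m = begin
  qInt x (suc m)                     ≡⟨ cong (foldr f (+ 0)) (sym (LP.upTo-∷ʳ m)) ⟩
  foldr f (+ 0) (upTo m ++ m ∷ [])   ≡⟨ LP.foldr-++ f (+ 0) (upTo m) (m ∷ []) ⟩
  foldr f (x ^ℤ m +ℤ + 0) (upTo m)   ≡⟨ foldr-+ (upTo m) ⟩
  qInt x m +ℤ (x ^ℤ m +ℤ + 0)        ≡⟨ cong (qInt x m +ℤ_) (ZP.+-identityʳ _) ⟩
  qInt x m +ℤ x ^ℤ m                 ∎
  where
  open ≡-Reasoning
  f : ℕ → ℤ → ℤ
  f i acc = x ^ℤ i +ℤ acc
  foldr-+ : ∀ {z} is → foldr f z is ≡ foldr f (+ 0) is +ℤ z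
  foldr-+ []       = sym (ZP.+-identityˡ _)
  foldr-+ (i ∷ is) = trans (cong (x ^ℤ i +ℤ_) (foldr-+ is)) (sym (ZP.+-assoc (x ^ℤ i) _ _))

qInt-+ : ∀ x m p → qInt x (m + p) ≡ qInt x m +ℤ x ^ℤ m *ℤ qInt x p
qInt-+ x m zero = begin
  qInt x (m + 0)             ≡⟨ cong (qInt x) (NP.+-identityʳ m) ⟩
  qInt x m                   ≡⟨ sym (ZP.+-identityʳ _) ⟩
  qInt x m +ℤ + 0            ≡⟨ cong (qInt x m +ℤ_) (sym (ZP.*-zeroʳ (x ^ℤ m))) ⟩
  qInt x m +ℤ x ^ℤ m *ℤ + 0  ∎
  where open ≡-Reasoning
qInt-+ x m (suc p) = begin
  qInt x (m + suc p)                                     ≡⟨ cong (qInt x) (NP.+-suc m p) ⟩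
  qInt x (suc (m + p))                                   ≡⟨ qInt-suc x (m + p) ⟩
  qInt x (m + p) +ℤ x ^ℤ (m + p)                         ≡⟨ cong₂ _+ℤ_ (qInt-+ x m p) (ZP.^-distribˡ-+-* x m p) ⟩
  (qInt x m +ℤ x ^ℤ m *ℤ qInt x p) +ℤ x ^ℤ m *ℤ x ^ℤ p   ≡⟨ factor (qInt x m) (x ^ℤ m) (qInt x p) (x ^ℤ p) ⟩
  qInt x m +ℤ x ^ℤ m *ℤ (qInt x p +ℤ x ^ℤ p)             ≡⟨ cong (λ z → qInt x m +ℤ x ^ℤ m *ℤ z) (sym (qInt-suc x p)) ⟩
  qInt x m +ℤ x ^ℤ m *ℤ qInt x (suc p)                   ∎
  where
  open ≡-Reasoning
  factor : ∀ a b c d → (a +ℤ b *ℤ c) +ℤ b *ℤ d ≡ a +ℤ b *ℤ (c +ℤ d)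
  factor = solve-∀

-- qBinom x a b is the Gaussian binomial [a + b choose b]_x.
qBinom : ℤ → ℕ → ℕ → ℤ
qBinom x zero    b       = + 1
qBinom x (suc a) zero    = + 1
qBinom x (suc a) (suc b) = qBinom x (suc a) b +ℤ x ^ℤ suc b *ℤ qBinom x a (suc b)

qBinom-pascal′ : ∀ x a b → qBinom x (suc a) (suc b) ≡ x ^ℤ suc a *ℤ qBinom x (suc a) b +ℤ qBinom x a (suc b)
qBinom-pascal′ x zero zero = base x
  where
  base : ∀ x → + 1 +ℤ x *ℤ + 1 *ℤ + 1 ≡ x *ℤ + 1 *ℤ + 1 +ℤ + 1
  base = solve-∀
qBinom-pascal′ x zero (suc b) = begin
  qBinom x 1 (suc b) +ℤ x *ℤ B *ℤ + 1                          ≡⟨ cong (_+ℤ x *ℤ B *ℤ + 1) (qBinom-pascal′ x zero b) ⟩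
  (x *ℤ + 1 *ℤ qBinom x 1 b +ℤ + 1) +ℤ x *ℤ B *ℤ + 1            ≡⟨ step x B (qBinom x 1 b) ⟩
  x *ℤ + 1 *ℤ (qBinom x 1 b +ℤ B *ℤ + 1) +ℤ + 1                ∎
  where
  open ≡-Reasoning
  B = x ^ℤ suc b
  step : ∀ x B P → (x *ℤ + 1 *ℤ P +ℤ + 1) +ℤ x *ℤ B *ℤ + 1 ≡ x *ℤ + 1 *ℤ (P +ℤ B *ℤ + 1) +ℤ + 1
  step = solve-∀
qBinom-pascal′ x (suc a) zero = begin
  + 1 +ℤ x *ℤ + 1 *ℤ qBinom x (suc a) 1                        ≡⟨ cong (λ z → + 1 +ℤ x *ℤ + 1 *ℤ z) (qBinom-pascal′ x a zero) ⟩
  + 1 +ℤ x *ℤ + 1 *ℤ (A *ℤ + 1 +ℤ qBinom x a 1)                ≡⟨ step x A (qBinom x a 1) ⟩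
  x *ℤ A *ℤ + 1 +ℤ (+ 1 +ℤ x *ℤ + 1 *ℤ qBinom x a 1)            ∎
  where
  open ≡-Reasoning
  A = x ^ℤ suc a
  step : ∀ x A P → + 1 +ℤ x *ℤ + 1 *ℤ (A *ℤ + 1 +ℤ P) ≡ x *ℤ A *ℤ + 1 +ℤ (+ 1 +ℤ x *ℤ + 1 *ℤ P)
  step = solve-∀
qBinom-pascal′ x (suc a) (suc b) = begin
  qBinom x (2 + a) (suc b) +ℤ x *ℤ B *ℤ qBinom x (suc a) (2 + b)
    ≡⟨ cong₂ (λ u v → u +ℤ x *ℤ B *ℤ v) (qBinom-pascal′ x (suc a) b) (qBinom-pascal′ x a (suc b)) ⟩
  (x *ℤ A *ℤ P +ℤ R) +ℤ x *ℤ B *ℤ (A *ℤ R +ℤ S)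
    ≡⟨ step x A B P R S ⟩
  x *ℤ A *ℤ (P +ℤ B *ℤ R) +ℤ (R +ℤ x *ℤ B *ℤ S) ∎
  where
  open ≡-Reasoning
  A = x ^ℤ suc a
  B = x ^ℤ suc b
  P = qBinom x (2 + a) b
  R = qBinom x (suc a) (suc b)
  S = qBinom x a (2 + b)
  step : ∀ x A B P R S →
    (x *ℤ A *ℤ P +ℤ R) +ℤ x *ℤ B *ℤ (A *ℤ R +ℤ S) ≡ x *ℤ A *ℤ (P +ℤ B *ℤ R) +ℤ (R +ℤ x *ℤ B *ℤ S)
  step = solve-∀

qBinom-zeroʳ : ∀ x a → qBinom x a 0 ≡ + 1
qBinom-zeroʳ x zero    = refl
qBinom-zeroʳ x (suc a) = refl

PascalExponents : ℕ → ℕ → ℕ → ℕ → ℕ → Set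
PascalExponents a b α β γ = (α ≡ γ + suc b × β ≡ γ) ⊎ (α ≡ γ × β ≡ γ + suc a)

qBinom-combine : ∀ x a b {α β γ} → PascalExponents a b α β γ →
  x ^ℤ α *ℤ qBinom x a (suc b) +ℤ x ^ℤ β *ℤ qBinom x (suc a) b ≡ x ^ℤ γ *ℤ qBinom x (suc a) (suc b)
qBinom-combine x a b {γ = γ} (inj₁ (refl , refl)) = begin
  x ^ℤ (γ + suc b) *ℤ S +ℤ x ^ℤ γ *ℤ P      ≡⟨ cong (λ y → y *ℤ S +ℤ x ^ℤ γ *ℤ P) (ZP.^-distribˡ-+-* x γ (suc b)) ⟩
  x ^ℤ γ *ℤ x ^ℤ suc b *ℤ S +ℤ x ^ℤ γ *ℤ P  ≡⟨ step (x ^ℤ γ) (x ^ℤ suc b) S P ⟩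
  x ^ℤ γ *ℤ (P +ℤ x ^ℤ suc b *ℤ S)          ∎
  where
  open ≡-Reasoning
  S = qBinom x a (suc b)
  P = qBinom x (suc a) b
  step : ∀ g y s p → g *ℤ y *ℤ s +ℤ g *ℤ p ≡ g *ℤ (p +ℤ y *ℤ s)
  step = solve-∀
qBinom-combine x a b {γ = γ} (inj₂ (refl , refl)) = begin
  x ^ℤ γ *ℤ S +ℤ x ^ℤ (γ + suc a) *ℤ P      ≡⟨ cong (λ y → x ^ℤ γ *ℤ S +ℤ y *ℤ P) (ZP.^-distribˡ-+-* x γ (suc a)) ⟩
  x ^ℤ γ *ℤ S +ℤ x ^ℤ γ *ℤ x ^ℤ suc a *ℤ P  ≡⟨ step (x ^ℤ γ) (x ^ℤ suc a) S P ⟩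
  x ^ℤ γ *ℤ (x ^ℤ suc a *ℤ P +ℤ S)          ≡⟨ cong (x ^ℤ γ *ℤ_) (sym (qBinom-pascal′ x a b)) ⟩
  x ^ℤ γ *ℤ qBinom x (suc a) (suc b)        ∎
  where
  open ≡-Reasoning
  S = qBinom x a (suc b)
  P = qBinom x (suc a) b
  step : ∀ g y s p → g *ℤ s +ℤ g *ℤ y *ℤ p ≡ g *ℤ (y *ℤ p +ℤ s)
  step = solve-∀

qBinom-qFact : ∀ x a b → qBinom x a b *ℤ qFact x a *ℤ qFact x b ≡ qFact x (a + b)
qBinom-qFact x zero b = trans (cong (_*ℤ qFact x b) (ZP.*-identityˡ (+ 1))) (ZP.*-identityˡ _)
qBinom-qFact x (suc a) zero = begin
  + 1 *ℤ qFact x (suc a) *ℤ + 1  ≡⟨ ZP.*-identityʳ _ ⟩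
  + 1 *ℤ qFact x (suc a)         ≡⟨ ZP.*-identityˡ _ ⟩
  qFact x (suc a)                ≡⟨ cong (qFact x) (sym (NP.+-identityʳ (suc a))) ⟩
  qFact x (suc a + 0)            ∎
  where open ≡-Reasoning
qBinom-qFact x (suc a) (suc b) = begin
  (qBinom x (suc a) b +ℤ X *ℤ qBinom x a (suc b)) *ℤ (Fa *ℤ Ia) *ℤ (Fb *ℤ Ib)
    ≡⟨ regroup (qBinom x (suc a) b) X (qBinom x a (suc b)) Fa Ia Fb Ib ⟩
  qBinom x (suc a) b *ℤ qFact x (suc a) *ℤ Fb *ℤ Ib +ℤ X *ℤ (qBinom x a (suc b) *ℤ Fa *ℤ qFact x (suc b)) *ℤ Ia
    ≡⟨ cong₂ (λ u v → u *ℤ Ib +ℤ X *ℤ v *ℤ Ia) (qBinom-qFact x (suc a) b) (qBinom-qFact x a (suc b)) ⟩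
  qFact x (suc a + b) *ℤ Ib +ℤ X *ℤ qFact x (a + suc b) *ℤ Ia
    ≡⟨ cong (λ m → qFact x (suc a + b) *ℤ Ib +ℤ X *ℤ qFact x m *ℤ Ia) (NP.+-suc a b) ⟩
  F *ℤ Ib +ℤ X *ℤ F *ℤ Ia
    ≡⟨ factor F Ib X Ia ⟩
  F *ℤ (qInt x (suc b) +ℤ X *ℤ qInt x (suc a))
    ≡⟨ cong (F *ℤ_) (sym (qInt-+ x (suc b) (suc a))) ⟩
  F *ℤ qInt x (suc b + suc a)
    ≡⟨ cong (λ m → F *ℤ qInt x m) (trans (NP.+-comm (suc b) (suc a)) (cong suc (NP.+-suc a b))) ⟩
  qFact x (2 + (a + b))
    ≡⟨ cong (λ m → qFact x (suc m)) (sym (NP.+-suc a b)) ⟩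
  qFact x (suc a + suc b) ∎
  where
  open ≡-Reasoning
  X  = x ^ℤ suc b
  Fa = qFact x a
  Fb = qFact x b
  Ia = qInt x (suc a)
  Ib = qInt x (suc b)
  F  = qFact x (suc (a + b))
  regroup : ∀ P X R A I B J →
    (P +ℤ X *ℤ R) *ℤ (A *ℤ I) *ℤ (B *ℤ J) ≡ P *ℤ (A *ℤ I) *ℤ B *ℤ J +ℤ X *ℤ (R *ℤ A *ℤ (B *ℤ J)) *ℤ I
  regroup = solve-∀
  factor : ∀ F I X J → F *ℤ I +ℤ X *ℤ F *ℤ J ≡ F *ℤ (I +ℤ X *ℤ J)
  factor = solve-∀

if-same : {A : Set} (e : Bool) {a : A} → (if e then a else a) ≡ a
if-same true  = refl
if-same false = refl

<ᵇ-true⇒< : ∀ m n → (m <ᵇ n) ≡ true → m < n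
<ᵇ-true⇒< m n e = NP.<ᵇ⇒< m n (subst T (sym e) tt)

<⇒<ᵇ-true : ∀ m n → m < n → (m <ᵇ n) ≡ true
<⇒<ᵇ-true m n p with m <ᵇ n | NP.<⇒<ᵇ p
... | true | _ = refl

≥⇒<ᵇ-false : ∀ m n → n ≤ m → (m <ᵇ n) ≡ false
≥⇒<ᵇ-false m n p with m <ᵇ n in eq
... | false = refl
... | true  = ⊥-elim (NP.<⇒≱ (<ᵇ-true⇒< m n eq) p)

-- The derangement σ enters the descent computations only through its letters together with
-- their positions r in σ.  After fixed points are inserted, a letter followed by a fixed point
-- is a descent iff the letter is uncolored with value above r (aboveᵇ), and a fixed point
-- followed by the letter is a descent iff the letter is colored or has value below r (belowᵇ).
aboveᵇ : ℕ → Letter → Bool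
aboveᵇ r (v , t) = (t ≡ᵇ 0) ∧ (r <ᵇ v)

belowᵇ : ℕ → Letter → Bool
belowᵇ r (v , t) = (0 <ᵇ t) ∨ ((t ≡ᵇ 0) ∧ (v <ᵇ r))

AboveXorBelow : ℕ × Letter → Set
AboveXorBelow (r , l) = belowᵇ r l ≡ not (aboveᵇ r l)

above-below⇒descent : ∀ r l l′ → aboveᵇ r l ≡ true → belowᵇ (suc r) l′ ≡ true → (l′ <L l) ≡ true
above-below⇒descent r (v , zero)  (v′ , suc t′) _ _ = refl
above-below⇒descent r (v , zero)  (v′ , zero)   above below =
  <⇒<ᵇ-true v′ v (NP.<-≤-trans (<ᵇ-true⇒< v′ (suc r) below) (<ᵇ-true⇒< r v above))
above-below⇒descent r (v , suc t) l′ () _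

below-above⇒ascent : ∀ r l l′ → belowᵇ r l ≡ true → aboveᵇ (suc r) l′ ≡ true → (l′ <L l) ≡ false
below-above⇒ascent r (v , suc t) (v′ , zero)   _ _ = refl
below-above⇒ascent r (v , zero)  (v′ , zero)   below above =
  ≥⇒<ᵇ-false v′ v (NP.<⇒≤ (NP.<-trans (<ᵇ-true⇒< v r below) (NP.<-trans (NP.n<1+n r) (<ᵇ-true⇒< (suc r) v′ above))))
below-above⇒ascent r l (v′ , suc t′) _ ()

data Cell : Set where
  fixedCell  : Cell
  letterCell : ℕ → Letter → Cell

cellDescent : Cell → Cell → Bool
cellDescent fixedCell        fixedCell          = false
cellDescent (letterCell r l) fixedCell          = aboveᵇ r l
cellDescent fixedCell        (letterCell r l)   = belowᵇ r l
cellDescent (letterCell r l) (letterCell r′ l′) = l′ <L l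

-- Cell lists are stored from right to left: comajWith d is the major index of the reversed
-- list, a descent d y z between neighbours y z (in left-to-right order) counting the position of y.
comajWith : {A : Set} → (A → A → Bool) → List A → ℕ
comajWith d []          = 0
comajWith d (z ∷ [])    = 0
comajWith d (z ∷ y ∷ w) = (if d y z then suc (length w) else 0) + comajWith d (y ∷ w)

letterDescent : Letter → Letter → Bool
letterDescent l l′ = l′ <L l

lettersComaj : List (ℕ × Letter) → ℕ
lettersComaj rls = comajWith letterDescent (map proj₂ rls)

-- true marks a fixed cell, false the next letter.
interleave : List Bool → List (ℕ × Letter) → List Cell
interleave []           rls              = []
interleave (true ∷ bs)  rls              = fixedCell ∷ interleave bs rls
interleave (false ∷ bs) []               = fixedCell ∷ interleave bs []
interleave (false ∷ bs) ((r , l) ∷ rls)  = letterCell r l ∷ interleave bs rls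

length-interleave : ∀ bs rls → length (interleave bs rls) ≡ length bs
length-interleave []           rls             = refl
length-interleave (true ∷ bs)  rls             = cong suc (length-interleave bs rls)
length-interleave (false ∷ bs) []              = cong suc (length-interleave bs [])
length-interleave (false ∷ bs) (_ ∷ rls)       = cong suc (length-interleave bs rls)

shuffles : ℕ → ℕ → List (List Bool)
shuffles zero    zero    = [] ∷ []
shuffles zero    (suc b) = map (false ∷_) (shuffles zero b)
shuffles (suc a) zero    = map (true ∷_) (shuffles a zero)
shuffles (suc a) (suc b) = map (true ∷_) (shuffles a (suc b)) ++ map (false ∷_) (shuffles (suc a) b)

shuffles-length : ∀ a b {bs} → bs ∈ shuffles a b → length bs ≡ a + b
shuffles-length zero    zero    (here refl) = refl
shuffles-length zero    (suc b) p with MP.∈-map⁻ (false ∷_) p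
... | _ , q , refl = cong suc (shuffles-length zero b q)
shuffles-length (suc a) zero    p with MP.∈-map⁻ (true ∷_) p
... | _ , q , refl = cong suc (shuffles-length a zero q)
shuffles-length (suc a) (suc b) p with MP.∈-++⁻ (map (true ∷_) (shuffles a (suc b))) p
... | inj₁ p₁ with MP.∈-map⁻ (true ∷_) p₁
...   | _ , q , refl = cong suc (shuffles-length a (suc b) q)
shuffles-length (suc a) (suc b) p | inj₂ p₂ with MP.∈-map⁻ (false ∷_) p₂
...   | _ , q , refl = cong suc (trans (shuffles-length (suc a) b q) (sym (NP.+-suc a b)))

sumℤ-shuffles : (f : List Bool → ℤ) (a b : ℕ) →
  sumℤ (map f (shuffles (suc a) (suc b)))
    ≡ sumℤ (map (f ∘ (true ∷_)) (shuffles a (suc b))) +ℤ sumℤ (map (f ∘ (false ∷_)) (shuffles (suc a) b))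
sumℤ-shuffles f a b = begin
  sumℤ (map f (map (true ∷_) Ts ++ map (false ∷_) Fs))
    ≡⟨ cong sumℤ (LP.map-++ f (map (true ∷_) Ts) _) ⟩
  sumℤ (map f (map (true ∷_) Ts) ++ map f (map (false ∷_) Fs))
    ≡⟨ sumℤ-++ (map f (map (true ∷_) Ts)) _ ⟩
  sumℤ (map f (map (true ∷_) Ts)) +ℤ sumℤ (map f (map (false ∷_) Fs))
    ≡⟨ cong₂ _+ℤ_ (cong sumℤ (sym (LP.map-∘ Ts))) (cong sumℤ (sym (LP.map-∘ Fs))) ⟩
  sumℤ (map (f ∘ (true ∷_)) Ts) +ℤ sumℤ (map (f ∘ (false ∷_)) Fs) ∎
  where
  open ≡-Reasoning
  Ts = shuffles a (suc b)
  Fs = shuffles (suc a) b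

-- The letters of a derangement, carrying their positions b, b-1, …, 1.
Ranked : ℕ → List (ℕ × Letter) → Set
Ranked zero    []               = ⊤
Ranked zero    (_ ∷ _)          = ⊥
Ranked (suc b) []               = ⊥
Ranked (suc b) ((r , l) ∷ rls)  = (r ≡ suc b) × AboveXorBelow (r , l) × Ranked b rls

Ranked-length : ∀ b rls → Ranked b rls → length (map proj₂ rls) ≡ b
Ranked-length zero    []        _               = refl
Ranked-length (suc b) (_ ∷ rls) (_ , _ , ranked) = cong suc (Ranked-length b rls ranked)

headAbove : List (ℕ × Letter) → Bool
headAbove []            = false
headAbove ((r , l) ∷ _) = aboveᵇ r l

-- Exponent bookkeeping for sumAfter-letter: e and e₂ tell whether the two rightmost letters
-- lie above their positions, d whether they form a descent.
letter-exponents : ∀ e₂ e d a b m → (e₂ ≡ true → e ≡ false → d ≡ true) → (e₂ ≡ false → e ≡ true → d ≡ false) →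
  PascalExponents a b ((if not e then suc (a + suc b) else 0) + (m + (if e₂ then suc b else 0)))
                      ((if d then suc (suc a + b) else 0) + (m + (if e₂ then 0 else suc a)))
                      (((if d then suc b else 0) + m) + (if e then 0 else suc a))
letter-exponents true  true  false a b m _ _ = inj₁ (sym (NP.+-assoc m 0 (suc b)) , refl)
letter-exponents true  true  true  a b m _ _ = inj₂ (trans (NP.+-comm m (suc b)) (sym (NP.+-identityʳ _)) , eq a b m)
  where
  eq : ∀ a b m → suc (suc a + b) + (m + 0) ≡ (suc b + m) + 0 + suc a
  eq = ℕ-solve-∀
letter-exponents true  false true  a b m _ _ = inj₁ (eq₁ a b m , eq₂ a b m)
  where
  eq₁ : ∀ a b m → suc (a + suc b) + (m + suc b) ≡ (suc b + m) + suc a + suc b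
  eq₁ = ℕ-solve-∀
  eq₂ : ∀ a b m → suc (suc a + b) + (m + 0) ≡ (suc b + m) + suc a
  eq₂ = ℕ-solve-∀
letter-exponents true  false false a b m h _ with h refl refl
... | ()
letter-exponents false true  false a b m _ _ = inj₂ (refl , sym (NP.+-assoc m 0 (suc a)))
letter-exponents false true  true  a b m _ h with h refl refl
... | ()
letter-exponents false false false a b m _ _ = inj₁ (eq a b m , refl)
  where
  eq : ∀ a b m → suc (a + suc b) + (m + 0) ≡ m + suc a + suc b
  eq = ℕ-solve-∀
letter-exponents false false true  a b m _ _ = inj₂ (eq₁ a b m , eq₂ a b m)
  where
  eq₁ : ∀ a b m → suc (a + suc b) + (m + 0) ≡ (suc b + m) + suc a
  eq₁ = ℕ-solve-∀
  eq₂ : ∀ a b m → suc (suc a + b) + (m + suc a) ≡ (suc b + m) + suc a + suc a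
  eq₂ = ℕ-solve-∀

fixed-exponents : ∀ e a b m →
  PascalExponents a b (m + (if e then suc b else 0))
                      ((if e then suc (suc a + b) else 0) + (m + (if e then 0 else suc a)))
                      (m + (if e then suc b else 0))
fixed-exponents true  a b m = inj₂ (refl , eq a b m)
  where
  eq : ∀ a b m → suc (suc a + b) + (m + 0) ≡ m + suc b + suc a
  eq = ℕ-solve-∀
fixed-exponents false a b m = inj₂ (refl , sym (NP.+-assoc m 0 (suc a)))

module ShuffleSums (x : ℤ) where
  open ≡-Reasoning

  weight : List Cell → ℤ
  weight cs = x ^ℤ comajWith cellDescent cs

  shuffleSum : ℕ → ℕ → List (ℕ × Letter) → ℤ
  shuffleSum a b rls = sumℤ (map (λ bs → weight (interleave bs rls)) (shuffles a b))

  sumAfter : Cell → ℕ → ℕ → List (ℕ × Letter) → ℤ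
  sumAfter c a b rls = sumℤ (map (λ bs → weight (c ∷ interleave bs rls)) (shuffles a b))

  sumAfter-∷ : ∀ c′ c a b rls →
    sumℤ (map (λ bs → weight (c′ ∷ c ∷ interleave bs rls)) (shuffles a b))
      ≡ x ^ℤ (if cellDescent c c′ then suc (a + b) else 0) *ℤ sumAfter c a b rls
  sumAfter-∷ c′ c a b rls = begin
    sumℤ (map (λ bs → weight (c′ ∷ c ∷ interleave bs rls)) (shuffles a b))
      ≡⟨ sumℤ-map-cong (shuffles a b) (λ {bs} bs∈ → split {bs} (shuffles-length a b bs∈)) ⟩
    sumℤ (map (λ bs → x ^ℤ δ *ℤ weight (c ∷ interleave bs rls)) (shuffles a b))
      ≡⟨ sumℤ-map-*ˡ (x ^ℤ δ) (λ bs → weight (c ∷ interleave bs rls)) (shuffles a b) ⟩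
    x ^ℤ δ *ℤ sumAfter c a b rls ∎
    where
    δ = if cellDescent c c′ then suc (a + b) else 0
    split : ∀ {bs} → length bs ≡ a + b → weight (c′ ∷ c ∷ interleave bs rls) ≡ x ^ℤ δ *ℤ weight (c ∷ interleave bs rls)
    split {bs} len = trans
      (cong (λ n → x ^ℤ ((if cellDescent c c′ then suc n else 0) + comajWith cellDescent (c ∷ interleave bs rls)))
            (trans (length-interleave bs rls) len))
      (ZP.^-distribˡ-+-* x δ _)

  ^-*-merge : ∀ m n z → x ^ℤ m *ℤ (x ^ℤ n *ℤ z) ≡ x ^ℤ (m + n) *ℤ z
  ^-*-merge m n z = trans (sym (ZP.*-assoc (x ^ℤ m) _ z)) (cong (_*ℤ z) (sym (ZP.^-distribˡ-+-* x m n)))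

  -- Peeling off the second cell from the right, the two sums satisfy recurrences that are
  -- solved by these closed forms, the Pascal rules of qBinom doing the combining.
  sumAfter-fixed : ∀ a b rls → Ranked b rls →
    sumAfter fixedCell a b rls ≡ x ^ℤ (lettersComaj rls + (if headAbove rls then b else 0)) *ℤ qBinom x a b
  sumAfter-letter : ∀ a b r l rls → Ranked (suc b) ((r , l) ∷ rls) →
    sumAfter (letterCell r l) a b rls ≡ x ^ℤ (lettersComaj ((r , l) ∷ rls) + (if aboveᵇ r l then 0 else a)) *ℤ qBinom x a b

  sumAfter-fixed zero zero [] _ = refl
  sumAfter-fixed zero (suc b) ((r , l) ∷ rls) ranked = begin
    sumAfter fixedCell 0 (suc b) ((r , l) ∷ rls)
      ≡⟨ cong sumℤ (sym (LP.map-∘ (shuffles 0 b))) ⟩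
    sumℤ (map (λ bs → weight (fixedCell ∷ letterCell r l ∷ interleave bs rls)) (shuffles 0 b))
      ≡⟨ sumAfter-∷ fixedCell (letterCell r l) 0 b rls ⟩
    x ^ℤ (if aboveᵇ r l then suc b else 0) *ℤ sumAfter (letterCell r l) 0 b rls
      ≡⟨ cong (x ^ℤ (if aboveᵇ r l then suc b else 0) *ℤ_) (sumAfter-letter 0 b r l rls ranked) ⟩
    x ^ℤ (if aboveᵇ r l then suc b else 0) *ℤ (x ^ℤ (M + (if aboveᵇ r l then 0 else 0)) *ℤ qBinom x 0 b)
      ≡⟨ ^-*-merge (if aboveᵇ r l then suc b else 0) (M + (if aboveᵇ r l then 0 else 0)) (+ 1) ⟩
    x ^ℤ ((if aboveᵇ r l then suc b else 0) + (M + (if aboveᵇ r l then 0 else 0))) *ℤ + 1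
      ≡⟨ cong (λ n → x ^ℤ n *ℤ + 1) (exponent (aboveᵇ r l)) ⟩
    x ^ℤ (M + (if aboveᵇ r l then suc b else 0)) *ℤ + 1 ∎
    where
    M = lettersComaj ((r , l) ∷ rls)
    exponent : ∀ e → (if e then suc b else 0) + (M + (if e then 0 else 0)) ≡ M + (if e then suc b else 0)
    exponent true  = trans (cong (_+_ (suc b)) (NP.+-identityʳ M)) (NP.+-comm (suc b) M)
    exponent false = refl
  sumAfter-fixed (suc a) zero [] _ = begin
    sumAfter fixedCell (suc a) 0 []           ≡⟨ cong sumℤ (sym (LP.map-∘ (shuffles a 0))) ⟩
    sumAfter fixedCell a 0 []                 ≡⟨ sumAfter-fixed a 0 [] tt ⟩
    x ^ℤ 0 *ℤ qBinom x a 0                    ≡⟨ cong (x ^ℤ 0 *ℤ_) (qBinom-zeroʳ x a) ⟩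
    x ^ℤ 0 *ℤ + 1                             ∎
  sumAfter-fixed (suc a) (suc b) ((r , l) ∷ rls) ranked = begin
    sumAfter fixedCell (suc a) (suc b) ((r , l) ∷ rls)
      ≡⟨ sumℤ-shuffles (λ bs → weight (fixedCell ∷ interleave bs ((r , l) ∷ rls))) a b ⟩
    sumAfter fixedCell a (suc b) ((r , l) ∷ rls)
      +ℤ sumℤ (map (λ bs → weight (fixedCell ∷ letterCell r l ∷ interleave bs rls)) (shuffles (suc a) b))
      ≡⟨ cong₂ _+ℤ_ (sumAfter-fixed a (suc b) ((r , l) ∷ rls) ranked) (sumAfter-∷ fixedCell (letterCell r l) (suc a) b rls) ⟩
    x ^ℤ (M + E (suc b)) *ℤ qBinom x a (suc b)
      +ℤ x ^ℤ E (suc (suc a + b)) *ℤ sumAfter (letterCell r l) (suc a) b rls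
      ≡⟨ cong (λ s → x ^ℤ (M + E (suc b)) *ℤ qBinom x a (suc b) +ℤ x ^ℤ E (suc (suc a + b)) *ℤ s)
              (sumAfter-letter (suc a) b r l rls ranked) ⟩
    x ^ℤ (M + E (suc b)) *ℤ qBinom x a (suc b)
      +ℤ x ^ℤ E (suc (suc a + b)) *ℤ (x ^ℤ (M + (if aboveᵇ r l then 0 else suc a)) *ℤ qBinom x (suc a) b)
      ≡⟨ cong (x ^ℤ (M + E (suc b)) *ℤ qBinom x a (suc b) +ℤ_) (^-*-merge (E (suc (suc a + b))) (M + (if aboveᵇ r l then 0 else suc a)) (qBinom x (suc a) b)) ⟩
    x ^ℤ (M + E (suc b)) *ℤ qBinom x a (suc b)
      +ℤ x ^ℤ (E (suc (suc a + b)) + (M + (if aboveᵇ r l then 0 else suc a))) *ℤ qBinom x (suc a) b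
      ≡⟨ qBinom-combine x a b (fixed-exponents (aboveᵇ r l) a b M) ⟩
    x ^ℤ (M + E (suc b)) *ℤ qBinom x (suc a) (suc b) ∎
    where
    M = lettersComaj ((r , l) ∷ rls)
    E : ℕ → ℕ
    E n = if aboveᵇ r l then n else 0

  sumAfter-letter zero zero r l [] _ = cong (λ n → x ^ℤ n *ℤ + 1) (exponent (aboveᵇ r l))
    where
    exponent : ∀ e → 0 ≡ 0 + (if e then 0 else 0)
    exponent true  = refl
    exponent false = refl
  sumAfter-letter zero (suc b) r l ((r₂ , l₂) ∷ rls) (_ , _ , ranked) = begin
    sumAfter (letterCell r l) 0 (suc b) ((r₂ , l₂) ∷ rls)
      ≡⟨ cong sumℤ (sym (LP.map-∘ (shuffles 0 b))) ⟩
    sumℤ (map (λ bs → weight (letterCell r l ∷ letterCell r₂ l₂ ∷ interleave bs rls)) (shuffles 0 b))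
      ≡⟨ sumAfter-∷ (letterCell r l) (letterCell r₂ l₂) 0 b rls ⟩
    x ^ℤ δ b *ℤ sumAfter (letterCell r₂ l₂) 0 b rls
      ≡⟨ cong (x ^ℤ δ b *ℤ_) (sumAfter-letter 0 b r₂ l₂ rls ranked) ⟩
    x ^ℤ δ b *ℤ (x ^ℤ (M + (if aboveᵇ r₂ l₂ then 0 else 0)) *ℤ + 1)
      ≡⟨ ^-*-merge (δ b) (M + (if aboveᵇ r₂ l₂ then 0 else 0)) (+ 1) ⟩
    x ^ℤ (δ b + (M + (if aboveᵇ r₂ l₂ then 0 else 0))) *ℤ + 1
      ≡⟨ cong (λ n → x ^ℤ n *ℤ + 1) (exponent (aboveᵇ r₂ l₂) (aboveᵇ r l)) ⟩
    x ^ℤ (δ (length (map proj₂ rls)) + M + (if aboveᵇ r l then 0 else 0)) *ℤ + 1 ∎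
    where
    M = lettersComaj ((r₂ , l₂) ∷ rls)
    δ : ℕ → ℕ
    δ n = if l <L l₂ then suc n else 0
    exponent : ∀ e₂ e → δ b + (M + (if e₂ then 0 else 0)) ≡ δ (length (map proj₂ rls)) + M + (if e then 0 else 0)
    exponent e₂ e = begin
      δ b + (M + (if e₂ then 0 else 0))   ≡⟨ cong (λ n → δ b + (M + n)) (if-same e₂) ⟩
      δ b + (M + 0)                       ≡⟨ sym (NP.+-assoc (δ b) M 0) ⟩
      δ b + M + 0                         ≡⟨ cong₂ (λ n k → δ n + M + k) (sym (Ranked-length b rls (proj₂ (proj₂ ranked)))) (sym (if-same e)) ⟩
      δ (length (map proj₂ rls)) + M + (if e then 0 else 0) ∎
  sumAfter-letter (suc a) zero r l [] (_ , split , _) = begin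
    sumAfter (letterCell r l) (suc a) 0 []
      ≡⟨ cong sumℤ (sym (LP.map-∘ (shuffles a 0))) ⟩
    sumℤ (map (λ bs → weight (letterCell r l ∷ fixedCell ∷ interleave bs [])) (shuffles a 0))
      ≡⟨ sumAfter-∷ (letterCell r l) fixedCell a 0 [] ⟩
    x ^ℤ (if belowᵇ r l then suc (a + 0) else 0) *ℤ sumAfter fixedCell a 0 []
      ≡⟨ cong₂ (λ e s → x ^ℤ (if e then suc (a + 0) else 0) *ℤ s) split (sumAfter-fixed a 0 [] tt) ⟩
    x ^ℤ (if not (aboveᵇ r l) then suc (a + 0) else 0) *ℤ (x ^ℤ 0 *ℤ qBinom x a 0)
      ≡⟨ cong₂ (λ n s → x ^ℤ n *ℤ (x ^ℤ 0 *ℤ s)) (exponent (aboveᵇ r l)) (qBinom-zeroʳ x a) ⟩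
    x ^ℤ (if aboveᵇ r l then 0 else suc a) *ℤ (x ^ℤ 0 *ℤ + 1)
      ≡⟨ ^-*-merge (if aboveᵇ r l then 0 else suc a) 0 (+ 1) ⟩
    x ^ℤ ((if aboveᵇ r l then 0 else suc a) + 0) *ℤ + 1
      ≡⟨ cong (λ n → x ^ℤ n *ℤ + 1) (NP.+-identityʳ (if aboveᵇ r l then 0 else suc a)) ⟩
    x ^ℤ (if aboveᵇ r l then 0 else suc a) *ℤ + 1 ∎
    where
    exponent : ∀ e → (if not e then suc (a + 0) else 0) ≡ (if e then 0 else suc a)
    exponent true  = refl
    exponent false = cong suc (NP.+-identityʳ a)
  sumAfter-letter (suc a) (suc b) r l ((r₂ , l₂) ∷ rls) (refl , split , ranked@(refl , split₂ , _)) = begin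
    sumAfter (letterCell r l) (suc a) (suc b) ((r₂ , l₂) ∷ rls)
      ≡⟨ sumℤ-shuffles (λ bs → weight (letterCell r l ∷ interleave bs ((r₂ , l₂) ∷ rls))) a b ⟩
    sumℤ (map (λ bs → weight (letterCell r l ∷ fixedCell ∷ interleave bs ((r₂ , l₂) ∷ rls))) (shuffles a (suc b)))
      +ℤ sumℤ (map (λ bs → weight (letterCell r l ∷ letterCell r₂ l₂ ∷ interleave bs rls)) (shuffles (suc a) b))
      ≡⟨ cong₂ _+ℤ_ (sumAfter-∷ (letterCell r l) fixedCell a (suc b) ((r₂ , l₂) ∷ rls))
                    (sumAfter-∷ (letterCell r l) (letterCell r₂ l₂) (suc a) b rls) ⟩
    x ^ℤ (if belowᵇ r l then suc (a + suc b) else 0) *ℤ sumAfter fixedCell a (suc b) ((r₂ , l₂) ∷ rls)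
      +ℤ x ^ℤ δ (suc (suc a + b)) *ℤ sumAfter (letterCell r₂ l₂) (suc a) b rls
      ≡⟨ cong₂ (λ e s → x ^ℤ (if e then suc (a + suc b) else 0) *ℤ s +ℤ x ^ℤ δ (suc (suc a + b)) *ℤ sumAfter (letterCell r₂ l₂) (suc a) b rls)
               split (sumAfter-fixed a (suc b) ((r₂ , l₂) ∷ rls) ranked) ⟩
    x ^ℤ (if not e then suc (a + suc b) else 0) *ℤ (x ^ℤ (M + (if e₂ then suc b else 0)) *ℤ qBinom x a (suc b))
      +ℤ x ^ℤ δ (suc (suc a + b)) *ℤ sumAfter (letterCell r₂ l₂) (suc a) b rls
      ≡⟨ cong (λ s → x ^ℤ (if not e then suc (a + suc b) else 0) *ℤ (x ^ℤ (M + (if e₂ then suc b else 0)) *ℤ qBinom x a (suc b))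
                      +ℤ x ^ℤ δ (suc (suc a + b)) *ℤ s)
              (sumAfter-letter (suc a) b r₂ l₂ rls ranked) ⟩
    x ^ℤ (if not e then suc (a + suc b) else 0) *ℤ (x ^ℤ (M + (if e₂ then suc b else 0)) *ℤ qBinom x a (suc b))
      +ℤ x ^ℤ δ (suc (suc a + b)) *ℤ (x ^ℤ (M + (if e₂ then 0 else suc a)) *ℤ qBinom x (suc a) b)
      ≡⟨ cong₂ _+ℤ_ (^-*-merge (if not e then suc (a + suc b) else 0) (M + (if e₂ then suc b else 0)) (qBinom x a (suc b)))
                    (^-*-merge (δ (suc (suc a + b))) (M + (if e₂ then 0 else suc a)) (qBinom x (suc a) b)) ⟩
    x ^ℤ ((if not e then suc (a + suc b) else 0) + (M + (if e₂ then suc b else 0))) *ℤ qBinom x a (suc b)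
      +ℤ x ^ℤ (δ (suc (suc a + b)) + (M + (if e₂ then 0 else suc a))) *ℤ qBinom x (suc a) b
      ≡⟨ qBinom-combine x a b (letter-exponents e₂ e (l <L l₂) a b M descent ascent) ⟩
    x ^ℤ ((δ (suc b) + M) + (if e then 0 else suc a)) *ℤ qBinom x (suc a) (suc b)
      ≡⟨ cong (λ n → x ^ℤ ((δ n + M) + (if e then 0 else suc a)) *ℤ qBinom x (suc a) (suc b))
              (sym (Ranked-length (suc b) ((r₂ , l₂) ∷ rls) ranked)) ⟩
    x ^ℤ ((δ (length (map proj₂ ((r₂ , l₂) ∷ rls))) + M) + (if e then 0 else suc a)) *ℤ qBinom x (suc a) (suc b) ∎
    where
    e  = aboveᵇ r l
    e₂ = aboveᵇ r₂ l₂
    M  = lettersComaj ((r₂ , l₂) ∷ rls)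
    δ : ℕ → ℕ
    δ n = if l <L l₂ then n else 0
    descent : e₂ ≡ true → e ≡ false → (l <L l₂) ≡ true
    descent above₂ not-above = above-below⇒descent r₂ l₂ l above₂ (trans split (cong not not-above))
    ascent : e₂ ≡ false → e ≡ true → (l <L l₂) ≡ false
    ascent not-above₂ above = below-above⇒ascent r₂ l₂ l (trans split₂ (cong not not-above₂)) above

  shuffleSum-closed : ∀ a b rls → Ranked b rls → shuffleSum a b rls ≡ x ^ℤ lettersComaj rls *ℤ qBinom x a b
  shuffleSum-closed zero zero [] _ = refl
  shuffleSum-closed zero (suc b) ((r , l) ∷ rls) ranked = begin
    shuffleSum 0 (suc b) ((r , l) ∷ rls)
      ≡⟨ cong sumℤ (sym (LP.map-∘ (shuffles 0 b))) ⟩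
    sumAfter (letterCell r l) 0 b rls
      ≡⟨ sumAfter-letter 0 b r l rls ranked ⟩
    x ^ℤ (M + (if aboveᵇ r l then 0 else 0)) *ℤ + 1
      ≡⟨ cong (λ n → x ^ℤ (M + n) *ℤ + 1) (if-same (aboveᵇ r l)) ⟩
    x ^ℤ (M + 0) *ℤ + 1
      ≡⟨ cong (λ n → x ^ℤ n *ℤ + 1) (NP.+-identityʳ M) ⟩
    x ^ℤ M *ℤ + 1 ∎
    where M = lettersComaj ((r , l) ∷ rls)
  shuffleSum-closed (suc a) zero [] _ = begin
    shuffleSum (suc a) 0 []     ≡⟨ cong sumℤ (sym (LP.map-∘ (shuffles a 0))) ⟩
    sumAfter fixedCell a 0 []   ≡⟨ sumAfter-fixed a 0 [] tt ⟩
    x ^ℤ 0 *ℤ qBinom x a 0      ≡⟨ cong (x ^ℤ 0 *ℤ_) (qBinom-zeroʳ x a) ⟩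
    x ^ℤ 0 *ℤ + 1               ∎
  shuffleSum-closed (suc a) (suc b) ((r , l) ∷ rls) ranked = begin
    shuffleSum (suc a) (suc b) ((r , l) ∷ rls)
      ≡⟨ sumℤ-shuffles (λ bs → weight (interleave bs ((r , l) ∷ rls))) a b ⟩
    sumAfter fixedCell a (suc b) ((r , l) ∷ rls) +ℤ sumAfter (letterCell r l) (suc a) b rls
      ≡⟨ cong₂ _+ℤ_ (sumAfter-fixed a (suc b) ((r , l) ∷ rls) ranked) (sumAfter-letter (suc a) b r l rls ranked) ⟩
    x ^ℤ (M + (if aboveᵇ r l then suc b else 0)) *ℤ qBinom x a (suc b)
      +ℤ x ^ℤ (M + (if aboveᵇ r l then 0 else suc a)) *ℤ qBinom x (suc a) b
      ≡⟨ qBinom-combine x a b (exponents (aboveᵇ r l)) ⟩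
    x ^ℤ M *ℤ qBinom x (suc a) (suc b) ∎
    where
    M = lettersComaj ((r , l) ∷ rls)
    exponents : ∀ e → PascalExponents a b (M + (if e then suc b else 0)) (M + (if e then 0 else suc a)) M
    exponents true  = inj₁ (refl , NP.+-identityʳ M)
    exponents false = inj₂ (NP.+-identityʳ M , refl)

-- Inserting fixed points and the major index

falses : List Bool → ℕ
falses []           = 0
falses (true ∷ bs)  = falses bs
falses (false ∷ bs) = suc (falses bs)

falsesBefore : List Bool → ℕ → ℕ
falsesBefore bs           zero    = 0
falsesBefore []           (suc p) = 0
falsesBefore (true ∷ bs)  (suc p) = falsesBefore bs p
falsesBefore (false ∷ bs) (suc p) = suc (falsesBefore bs p)

-- The position, counting from 1, of the v-th false (meaningful for 1 ≤ v ≤ falses bs).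
nthFalse : List Bool → ℕ → ℕ
nthFalse []           v             = 0
nthFalse (true ∷ bs)  v             = suc (nthFalse bs v)
nthFalse (false ∷ bs) zero          = 0
nthFalse (false ∷ bs) (suc zero)    = 1
nthFalse (false ∷ bs) (suc (suc v)) = suc (nthFalse bs (suc v))

Cursor : List Bool → ℕ → List Bool → ℕ → Set
Cursor bs p rest r = drop p bs ≡ rest × falsesBefore bs p ≡ r

cursor-start : ∀ bs → Cursor bs 0 bs 0
cursor-start bs = refl , refl

cursor-true : ∀ bs p {rest r} → Cursor bs p (true ∷ rest) r → Cursor bs (suc p) rest r
cursor-true []           zero    (() , _)
cursor-true []           (suc p) (() , _)
cursor-true (true ∷ bs)  zero    (refl , refl) = refl , refl
cursor-true (false ∷ bs) zero    (() , _)
cursor-true (true ∷ bs)  (suc p) cursor        = cursor-true bs p cursor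
cursor-true (false ∷ bs) (suc p) (d , refl)    = map₂ (cong suc) (cursor-true bs p (d , refl))

cursor-false : ∀ bs p {rest r} → Cursor bs p (false ∷ rest) r → Cursor bs (suc p) rest (suc r)
cursor-false []           zero    (() , _)
cursor-false []           (suc p) (() , _)
cursor-false (true ∷ bs)  zero    (() , _)
cursor-false (false ∷ bs) zero    (refl , refl) = refl , refl
cursor-false (true ∷ bs)  (suc p) cursor        = cursor-false bs p cursor
cursor-false (false ∷ bs) (suc p) (d , refl)    = map₂ (cong suc) (cursor-false bs p (d , refl))

falsesBefore≤falses : ∀ bs p → falsesBefore bs p ≤ falses bs
falsesBefore≤falses bs           zero    = z≤n
falsesBefore≤falses []           (suc p) = z≤n
falsesBefore≤falses (true ∷ bs)  (suc p) = falsesBefore≤falses bs p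
falsesBefore≤falses (false ∷ bs) (suc p) = s≤s (falsesBefore≤falses bs p)

ValueIn : ℕ → Letter → Set
ValueIn k (v , t) = 1 ≤ v × v ≤ k

<ᵇ-nthFalse : ∀ bs v p → 1 ≤ v → v ≤ falses bs → (p <ᵇ nthFalse bs v) ≡ (falsesBefore bs p <ᵇ v)
<ᵇ-nthFalse []           v             p       1≤v v≤  = ⊥-elim (NP.<⇒≱ 1≤v v≤)
<ᵇ-nthFalse (true ∷ bs)  (suc v)       zero    _   _   = refl
<ᵇ-nthFalse (true ∷ bs)  v             (suc p) 1≤v v≤  = <ᵇ-nthFalse bs v p 1≤v v≤
<ᵇ-nthFalse (false ∷ bs) (suc zero)    zero    _   _   = refl
<ᵇ-nthFalse (false ∷ bs) (suc zero)    (suc p) _   _   = refl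
<ᵇ-nthFalse (false ∷ bs) (suc (suc v)) zero    _   _   = refl
<ᵇ-nthFalse (false ∷ bs) (suc (suc v)) (suc p) _   (s≤s v≤) = <ᵇ-nthFalse bs (suc v) p (s≤s z≤n) v≤

falsesBefore-nthFalse : ∀ bs v → 1 ≤ v → v ≤ falses bs → falsesBefore bs (nthFalse bs v) ≡ v
falsesBefore-nthFalse []           v             1≤v v≤       = ⊥-elim (NP.<⇒≱ 1≤v v≤)
falsesBefore-nthFalse (true ∷ bs)  v             1≤v v≤       = falsesBefore-nthFalse bs v 1≤v v≤
falsesBefore-nthFalse (false ∷ bs) (suc zero)    _   _        = refl
falsesBefore-nthFalse (false ∷ bs) (suc (suc v)) _   (s≤s v≤) = cong suc (falsesBefore-nthFalse bs (suc v) (s≤s z≤n) v≤)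

nthFalse-<ᵇ : ∀ bs {v v′} → ValueIn (falses bs) (v , 0) → ValueIn (falses bs) (v′ , 0) →
  (nthFalse bs v′ <ᵇ nthFalse bs v) ≡ (v′ <ᵇ v)
nthFalse-<ᵇ bs {v} {v′} (1≤v , v≤) (1≤v′ , v′≤) =
  trans (<ᵇ-nthFalse bs v (nthFalse bs v′) 1≤v v≤) (cong (_<ᵇ v) (falsesBefore-nthFalse bs v′ 1≤v′ v′≤))

suc-<ᵇ-self : ∀ n → (suc n <ᵇ n) ≡ false
suc-<ᵇ-self zero    = refl
suc-<ᵇ-self (suc n) = suc-<ᵇ-self n

<ᵇ-suc : ∀ m p → (m <ᵇ suc p) ≡ not (p <ᵇ m)
<ᵇ-suc zero    zero    = refl
<ᵇ-suc zero    (suc p) = refl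
<ᵇ-suc (suc m) zero    = refl
<ᵇ-suc (suc m) (suc p) = <ᵇ-suc m p

≡ᵇ-refl : ∀ n → (n ≡ᵇ n) ≡ true
≡ᵇ-refl zero    = refl
≡ᵇ-refl (suc n) = ≡ᵇ-refl n

insertFixedFrom : ℕ → List Bool → Word → Word
insertFixedFrom i []           w       = []
insertFixedFrom i (true ∷ bs)  w       = (i , 0) ∷ insertFixedFrom (suc i) bs w
insertFixedFrom i (false ∷ bs) []      = []
insertFixedFrom i (false ∷ bs) (l ∷ w) = l ∷ insertFixedFrom (suc i) bs w

relabel : List Bool → Letter → Letter
relabel bs (v , t) = (nthFalse bs v , t)

-- The unique π with fixed points exactly at the true positions of bs and dp π = σ.
insertFixed : List Bool → Word → Word
insertFixed bs σ = insertFixedFrom 1 bs (map (relabel bs) σ)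

majWith : {A : Set} → (A → A → Bool) → ℕ → List A → ℕ
majWith d i []          = 0
majWith d i (x ∷ [])    = 0
majWith d i (x ∷ y ∷ w) = (if d x y then i else 0) + majWith d (suc i) (y ∷ w)

majFrom≡majWith : ∀ i w → majFrom i w ≡ majWith letterDescent i w
majFrom≡majWith i []          = refl
majFrom≡majWith i (x ∷ [])    = refl
majFrom≡majWith i (x ∷ y ∷ w) = cong (_+_ (if y <L x then i else 0)) (majFrom≡majWith (suc i) (y ∷ w))

module MajOfInsertion (bs : List Bool) where
  k = falses bs

  descent-fixed-letter : ∀ {p r} v t → falsesBefore bs p ≡ r → ValueIn k (v , t) →
    ((nthFalse bs v , t) <L (suc p , 0)) ≡ belowᵇ (suc r) (v , t)
  descent-fixed-letter v (suc t) _ _ = refl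
  descent-fixed-letter {p} {r} v zero refl (1≤v , v≤) = begin
    nthFalse bs v <ᵇ suc p              ≡⟨ <ᵇ-suc (nthFalse bs v) p ⟩
    not (p <ᵇ nthFalse bs v)            ≡⟨ cong not (<ᵇ-nthFalse bs v p 1≤v v≤) ⟩
    not (falsesBefore bs p <ᵇ v)        ≡⟨ sym (<ᵇ-suc v r) ⟩
    v <ᵇ suc r                          ∎
    where open ≡-Reasoning

  descent-letter-fixed : ∀ {p r} v t → falsesBefore bs p ≡ r → ValueIn k (v , t) →
    ((p , 0) <L (nthFalse bs v , t)) ≡ aboveᵇ r (v , t)
  descent-letter-fixed v (suc t) _ _ = refl
  descent-letter-fixed {p} v zero refl (1≤v , v≤) = <ᵇ-nthFalse bs v p 1≤v v≤

  descent-letter-letter : ∀ v t v′ t′ → ValueIn k (v , t) → ValueIn k (v′ , t′) →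
    ((nthFalse bs v′ , t′) <L (nthFalse bs v , t)) ≡ ((v′ , t′) <L (v , t))
  descent-letter-letter v t v′ t′ (1≤v , v≤) (1≤v′ , v′≤) =
    cong (λ b → (t <ᵇ t′) ∨ ((t′ ≡ᵇ t) ∧ b)) (nthFalse-<ᵇ bs (1≤v , v≤) (1≤v′ , v′≤))

  -- Each adjacent pair of the inserted word compares as the corresponding pair of cells.
  majFrom-insertFixedFrom : ∀ p rest r w → Cursor bs p rest r → All (ValueIn k) w → falses rest ≡ length w →
    majFrom (suc p) (insertFixedFrom (suc p) rest (map (relabel bs) w))
      ≡ majWith cellDescent (suc p) (interleave rest (indexFrom (suc r) w))
  majFrom-insertFixedFrom p []                   r w       _ _ _ = refl
  majFrom-insertFixedFrom p (true ∷ [])          r w       _ _ _ = refl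
  majFrom-insertFixedFrom p (false ∷ [])         r (_ ∷ _) _ _ _ = refl
  majFrom-insertFixedFrom p (false ∷ [])         r []      _ _ ()
  majFrom-insertFixedFrom p (true ∷ false ∷ rest) r [] _ _ ()
  majFrom-insertFixedFrom p (false ∷ _ ∷ rest)   r [] _ _ ()
  majFrom-insertFixedFrom p (true ∷ true ∷ rest) r w       cursor vals len =
    cong₂ _+_ (cong (λ b → if b then suc p else 0) (suc-<ᵇ-self (suc p)))
              (majFrom-insertFixedFrom (suc p) (true ∷ rest) r w (cursor-true bs p cursor) vals len)
  majFrom-insertFixedFrom p (true ∷ false ∷ rest) r ((v , t) ∷ w) cursor (val ∷ vals) len =
    cong₂ _+_ (cong (λ b → if b then suc p else 0) (descent-fixed-letter v t (proj₂ cursor) val))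
              (majFrom-insertFixedFrom (suc p) (false ∷ rest) r ((v , t) ∷ w) (cursor-true bs p cursor) (val ∷ vals) len)
  majFrom-insertFixedFrom p (false ∷ true ∷ rest) r ((v , t) ∷ w) cursor (val ∷ vals) len =
    cong₂ _+_ (cong (λ b → if b then suc p else 0) (descent-letter-fixed v t (proj₂ cursor″) val))
              (majFrom-insertFixedFrom (suc p) (true ∷ rest) (suc r) w cursor′ vals (NP.suc-injective len))
    where
    cursor′  = cursor-false bs p cursor
    cursor″  = cursor-true bs (suc p) cursor′
  majFrom-insertFixedFrom p (false ∷ false ∷ rest) r ((v , t) ∷ (v′ , t′) ∷ w) cursor (val ∷ val′ ∷ vals) len =
    cong₂ _+_ (cong (λ b → if b then suc p else 0) (descent-letter-letter v t v′ t′ val val′))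
              (majFrom-insertFixedFrom (suc p) (false ∷ rest) (suc r) ((v′ , t′) ∷ w) (cursor-false bs p cursor) (val′ ∷ vals) (NP.suc-injective len))
  majFrom-insertFixedFrom p (false ∷ false ∷ rest) r (_ ∷ []) _ _ len with NP.suc-injective len
  ... | ()

  maj-insertFixed : ∀ σ → All (ValueIn k) σ → k ≡ length σ →
    maj (insertFixed bs σ) ≡ majWith cellDescent 1 (interleave bs (indexFrom 1 σ))
  maj-insertFixed σ = majFrom-insertFixedFrom 0 bs 0 σ (cursor-start bs)

majWith-∷ʳ-∷ʳ : {A : Set} (d : A → A → Bool) (i : ℕ) (ws : List A) (y z : A) →
  majWith d i ((ws ∷ʳ y) ∷ʳ z) ≡ majWith d i (ws ∷ʳ y) + (if d y z then i + length ws else 0)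
majWith-∷ʳ-∷ʳ d i [] y z with d y z
... | true  = refl
... | false = refl
majWith-∷ʳ-∷ʳ d i (w ∷ []) y z =
  cong₂ _+_ (sym (NP.+-identityʳ _)) (trans (NP.+-identityʳ _) (cong (λ n → if d y z then n else 0) (NP.+-comm 1 i)))
majWith-∷ʳ-∷ʳ d i (w ∷ w′ ∷ ws) y z = begin
  δ + majWith d (suc i) (((w′ ∷ ws) ∷ʳ y) ∷ʳ z)
    ≡⟨ cong (_+_ δ) (majWith-∷ʳ-∷ʳ d (suc i) (w′ ∷ ws) y z) ⟩
  δ + (majWith d (suc i) ((w′ ∷ ws) ∷ʳ y) + (if d y z then suc i + suc (length ws) else 0))
    ≡⟨ sym (NP.+-assoc δ _ _) ⟩
  δ + majWith d (suc i) ((w′ ∷ ws) ∷ʳ y) + (if d y z then suc i + suc (length ws) else 0)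
    ≡⟨ cong (λ n → δ + majWith d (suc i) ((w′ ∷ ws) ∷ʳ y) + (if d y z then n else 0)) (sym (NP.+-suc i (suc (length ws)))) ⟩
  δ + majWith d (suc i) ((w′ ∷ ws) ∷ʳ y) + (if d y z then i + suc (suc (length ws)) else 0) ∎
  where
  open ≡-Reasoning
  δ = if d w w′ then i else 0

comajWith≡majWith-reverse : {A : Set} (d : A → A → Bool) (ys : List A) → comajWith d ys ≡ majWith d 1 (reverse ys)
comajWith≡majWith-reverse d []          = refl
comajWith≡majWith-reverse d (z ∷ [])    = refl
comajWith≡majWith-reverse d (z ∷ y ∷ w) = begin
  δ (length w) + comajWith d (y ∷ w)
    ≡⟨ NP.+-comm (δ (length w)) _ ⟩
  comajWith d (y ∷ w) + δ (length w)
    ≡⟨ cong₂ _+_ (comajWith≡majWith-reverse d (y ∷ w)) (cong δ (sym (LP.length-reverse w))) ⟩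
  majWith d 1 (reverse (y ∷ w)) + δ (length (reverse w))
    ≡⟨ cong (λ u → majWith d 1 u + δ (length (reverse w))) (LP.unfold-reverse y w) ⟩
  majWith d 1 (reverse w ∷ʳ y) + δ (length (reverse w))
    ≡⟨ sym (majWith-∷ʳ-∷ʳ d 1 (reverse w) y z) ⟩
  majWith d 1 ((reverse w ∷ʳ y) ∷ʳ z)
    ≡⟨ cong (λ u → majWith d 1 (u ∷ʳ z)) (sym (LP.unfold-reverse y w)) ⟩
  majWith d 1 (reverse (y ∷ w) ∷ʳ z)
    ≡⟨ cong (majWith d 1) (sym (LP.unfold-reverse z (y ∷ w))) ⟩
  majWith d 1 (reverse (z ∷ y ∷ w)) ∎
  where
  open ≡-Reasoning
  δ : ℕ → ℕ
  δ n = if d y z then suc n else 0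

falses-∷ʳ : ∀ bs b → falses (bs ∷ʳ b) ≡ falses (b ∷ bs)
falses-∷ʳ []           b     = refl
falses-∷ʳ (true ∷ bs)  true  = falses-∷ʳ bs true
falses-∷ʳ (true ∷ bs)  false = falses-∷ʳ bs false
falses-∷ʳ (false ∷ bs) true  = cong suc (falses-∷ʳ bs true)
falses-∷ʳ (false ∷ bs) false = cong suc (falses-∷ʳ bs false)

falses-reverse : ∀ bs → falses (reverse bs) ≡ falses bs
falses-reverse []       = refl
falses-reverse (b ∷ bs) = begin
  falses (reverse (b ∷ bs))  ≡⟨ cong falses (LP.unfold-reverse b bs) ⟩
  falses (reverse bs ∷ʳ b)   ≡⟨ falses-∷ʳ (reverse bs) b ⟩
  falses (b ∷ reverse bs)    ≡⟨ falses-∷-cong b (falses-reverse bs) ⟩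
  falses (b ∷ bs)            ∎
  where
  open ≡-Reasoning
  falses-∷-cong : ∀ b {cs ds} → falses cs ≡ falses ds → falses (b ∷ cs) ≡ falses (b ∷ ds)
  falses-∷-cong true  eq = eq
  falses-∷-cong false eq = cong suc eq

interleave-∷ʳ-true : ∀ bs rls → falses bs ≡ length rls → interleave (bs ∷ʳ true) rls ≡ interleave bs rls ∷ʳ fixedCell
interleave-∷ʳ-true []           []              _   = refl
interleave-∷ʳ-true []           (_ ∷ _)         ()
interleave-∷ʳ-true (false ∷ bs) []              ()
interleave-∷ʳ-true (true ∷ bs)  rls             len = cong (fixedCell ∷_) (interleave-∷ʳ-true bs rls len)
interleave-∷ʳ-true (false ∷ bs) ((r , l) ∷ rls) len = cong (letterCell r l ∷_) (interleave-∷ʳ-true bs rls (NP.suc-injective len))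

interleave-∷ʳ-false : ∀ bs rls rl → falses bs ≡ length rls →
  interleave (bs ∷ʳ false) (rls ∷ʳ rl) ≡ interleave bs rls ∷ʳ letterCell (proj₁ rl) (proj₂ rl)
interleave-∷ʳ-false []           []              _  _   = refl
interleave-∷ʳ-false []           (_ ∷ _)         _  ()
interleave-∷ʳ-false (false ∷ bs) []              _  ()
interleave-∷ʳ-false (true ∷ bs)  rls             rl len = cong (fixedCell ∷_) (interleave-∷ʳ-false bs rls rl len)
interleave-∷ʳ-false (false ∷ bs) ((r , l) ∷ rls) rl len = cong (letterCell r l ∷_) (interleave-∷ʳ-false bs rls rl (NP.suc-injective len))

reversed-length : ∀ bs (rls : List (ℕ × Letter)) → falses bs ≡ length rls → falses (reverse bs) ≡ length (reverse rls)
reversed-length bs rls len = trans (falses-reverse bs) (trans len (sym (LP.length-reverse rls)))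

reverse-interleave : ∀ bs rls → falses bs ≡ length rls → reverse (interleave bs rls) ≡ interleave (reverse bs) (reverse rls)
reverse-interleave []           []              _   = refl
reverse-interleave []           (_ ∷ _)         ()
reverse-interleave (false ∷ bs) []              ()
reverse-interleave (true ∷ bs)  rls             len = begin
  reverse (fixedCell ∷ interleave bs rls)               ≡⟨ LP.unfold-reverse fixedCell (interleave bs rls) ⟩
  reverse (interleave bs rls) ∷ʳ fixedCell              ≡⟨ cong (_∷ʳ fixedCell) (reverse-interleave bs rls len) ⟩
  interleave (reverse bs) (reverse rls) ∷ʳ fixedCell    ≡⟨ sym (interleave-∷ʳ-true (reverse bs) (reverse rls) (reversed-length bs rls len)) ⟩
  interleave (reverse bs ∷ʳ true) (reverse rls)         ≡⟨ cong (λ cs → interleave cs (reverse rls)) (sym (LP.unfold-reverse true bs)) ⟩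
  interleave (reverse (true ∷ bs)) (reverse rls)        ∎
  where open ≡-Reasoning
reverse-interleave (false ∷ bs) ((r , l) ∷ rls) len = begin
  reverse (letterCell r l ∷ interleave bs rls)                  ≡⟨ LP.unfold-reverse (letterCell r l) (interleave bs rls) ⟩
  reverse (interleave bs rls) ∷ʳ letterCell r l                 ≡⟨ cong (_∷ʳ letterCell r l) (reverse-interleave bs rls len′) ⟩
  interleave (reverse bs) (reverse rls) ∷ʳ letterCell r l       ≡⟨ sym (interleave-∷ʳ-false (reverse bs) (reverse rls) (r , l) (reversed-length bs rls len′)) ⟩
  interleave (reverse bs ∷ʳ false) (reverse rls ∷ʳ (r , l))     ≡⟨ cong₂ interleave (sym (LP.unfold-reverse false bs)) (sym (LP.unfold-reverse (r , l) rls)) ⟩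
  interleave (reverse (false ∷ bs)) (reverse ((r , l) ∷ rls))   ∎
  where
  open ≡-Reasoning
  len′ = NP.suc-injective len

rankDown : ℕ → List Letter → List (ℕ × Letter)
rankDown k []      = []
rankDown k (l ∷ w) = (k , l) ∷ rankDown (pred k) w

rankDown-∷ʳ : ∀ m w l → rankDown (m + length w) (w ∷ʳ l) ≡ rankDown (m + length w) w ∷ʳ (m , l)
rankDown-∷ʳ m []      l = cong (λ n → (n , l) ∷ []) (NP.+-identityʳ m)
rankDown-∷ʳ m (x ∷ w) l = cong ((m + suc (length w) , x) ∷_) (begin
  rankDown (pred (m + suc (length w))) (w ∷ʳ l)   ≡⟨ cong (λ n → rankDown (pred n) (w ∷ʳ l)) (NP.+-suc m (length w)) ⟩
  rankDown (m + length w) (w ∷ʳ l)                ≡⟨ rankDown-∷ʳ m w l ⟩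
  rankDown (m + length w) w ∷ʳ (m , l)            ≡⟨ cong (λ n → rankDown (pred n) w ∷ʳ (m , l)) (sym (NP.+-suc m (length w))) ⟩
  rankDown (pred (m + suc (length w))) w ∷ʳ (m , l) ∎)
  where open ≡-Reasoning

reverse-indexFrom : ∀ i σ → reverse (indexFrom (suc i) σ) ≡ rankDown (i + length σ) (reverse σ)
reverse-indexFrom i []      = refl
reverse-indexFrom i (l ∷ σ) = begin
  reverse ((suc i , l) ∷ indexFrom (2 + i) σ)                   ≡⟨ LP.unfold-reverse (suc i , l) (indexFrom (2 + i) σ) ⟩
  reverse (indexFrom (2 + i) σ) ∷ʳ (suc i , l)                  ≡⟨ cong (_∷ʳ (suc i , l)) (reverse-indexFrom (suc i) σ) ⟩
  rankDown (suc i + length σ) (reverse σ) ∷ʳ (suc i , l)        ≡⟨ cong (λ n → rankDown (suc i + n) (reverse σ) ∷ʳ (suc i , l)) (sym (LP.length-reverse σ)) ⟩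
  rankDown (suc i + length (reverse σ)) (reverse σ) ∷ʳ (suc i , l) ≡⟨ sym (rankDown-∷ʳ (suc i) (reverse σ) l) ⟩
  rankDown (suc i + length (reverse σ)) (reverse σ ∷ʳ l)        ≡⟨ cong₂ rankDown (trans (cong (_+_ (suc i)) (LP.length-reverse σ)) (sym (NP.+-suc i (length σ))))
                                                                                  (sym (LP.unfold-reverse l σ)) ⟩
  rankDown (i + suc (length σ)) (reverse (l ∷ σ))               ∎
  where open ≡-Reasoning

map-proj₂-rankDown : ∀ k w → map proj₂ (rankDown k w) ≡ w
map-proj₂-rankDown k []      = refl
map-proj₂-rankDown k (l ∷ w) = cong (l ∷_) (map-proj₂-rankDown (pred k) w)

rankDown-Ranked : ∀ k w → length w ≡ k → All AboveXorBelow (rankDown k w) → Ranked k (rankDown k w)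
rankDown-Ranked zero    []      _   _          = tt
rankDown-Ranked zero    (_ ∷ _) ()  _
rankDown-Ranked (suc k) []      ()  _
rankDown-Ranked (suc k) (l ∷ w) len (axb ∷ axbs) = refl , axb , rankDown-Ranked k w (NP.suc-injective len) axbs

nonFixed⇒AboveXorBelow : ∀ {p} → isFixed p ≡ false → AboveXorBelow p
nonFixed⇒AboveXorBelow {i , v , suc t} _ = refl
nonFixed⇒AboveXorBelow {i , v , zero} nonFixed with NP.<-cmp v i
... | tri< v<i _ _ = trans (<⇒<ᵇ-true v i v<i) (cong not (sym (≥⇒<ᵇ-false i v (NP.<⇒≤ v<i))))
... | tri> _ _ i<v = trans (≥⇒<ᵇ-false v i (NP.<⇒≤ i<v)) (cong not (sym (<⇒<ᵇ-true i v i<v)))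
... | tri≈ _ refl _ with trans (sym nonFixed) (cong (_∧ true) (≡ᵇ-refl v))
...   | ()

lettersComaj-rankDown : ∀ σ → lettersComaj (rankDown (length σ) (reverse σ)) ≡ maj σ
lettersComaj-rankDown σ = begin
  comajWith letterDescent (map proj₂ (rankDown (length σ) (reverse σ)))
    ≡⟨ cong (comajWith letterDescent) (map-proj₂-rankDown (length σ) (reverse σ)) ⟩
  comajWith letterDescent (reverse σ)               ≡⟨ comajWith≡majWith-reverse letterDescent (reverse σ) ⟩
  majWith letterDescent 1 (reverse (reverse σ))     ≡⟨ cong (majWith letterDescent 1) (LP.reverse-involutive σ) ⟩
  majWith letterDescent 1 σ                         ≡⟨ sym (majFrom≡majWith 1 σ) ⟩
  maj σ                                             ∎
  where open ≡-Reasoning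

length-indexFrom : ∀ i (w : Word) → length (indexFrom i w) ≡ length w
length-indexFrom i []      = refl
length-indexFrom i (_ ∷ w) = cong suc (length-indexFrom (suc i) w)

maj-insertFixed-reverse : ∀ bs σ → All (ValueIn (falses bs)) σ → falses bs ≡ length σ →
  maj (insertFixed (reverse bs) σ) ≡ comajWith cellDescent (interleave bs (rankDown (length σ) (reverse σ)))
maj-insertFixed-reverse bs σ vals len = begin
  maj (insertFixed (reverse bs) σ)
    ≡⟨ MajOfInsertion.maj-insertFixed (reverse bs) σ (subst (λ k → All (ValueIn k) σ) (sym (falses-reverse bs)) vals)
                                                        (trans (falses-reverse bs) len) ⟩
  majWith cellDescent 1 (interleave (reverse bs) (indexFrom 1 σ))
    ≡⟨ majWith≡comajWith-reverse (interleave (reverse bs) (indexFrom 1 σ)) ⟩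
  comajWith cellDescent (reverse (interleave (reverse bs) (indexFrom 1 σ)))
    ≡⟨ cong (comajWith cellDescent) (reverse-interleave (reverse bs) (indexFrom 1 σ)
                                       (trans (falses-reverse bs) (trans len (sym (length-indexFrom 1 σ))))) ⟩
  comajWith cellDescent (interleave (reverse (reverse bs)) (reverse (indexFrom 1 σ)))
    ≡⟨ cong₂ (λ cs rls → comajWith cellDescent (interleave cs rls)) (LP.reverse-involutive bs) (reverse-indexFrom 0 σ) ⟩
  comajWith cellDescent (interleave bs (rankDown (length σ) (reverse σ))) ∎
  where
  open ≡-Reasoning
  majWith≡comajWith-reverse : (cs : List Cell) → majWith cellDescent 1 cs ≡ comajWith cellDescent (reverse cs)
  majWith≡comajWith-reverse cs =
    sym (trans (comajWith≡majWith-reverse cellDescent (reverse cs)) (cong (majWith cellDescent 1) (LP.reverse-involutive cs)))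

-- Inserting fixed points and inversions

count-∷ : {A : Set} (p : A → Bool) (x : A) (xs : List A) → count p (x ∷ xs) ≡ (if p x then 1 else 0) + count p xs
count-∷ p x xs with p x
... | true  = refl
... | false = refl

count-↭ : {A : Set} (p : A → Bool) {xs ys : List A} → xs ↭ ys → count p xs ≡ count p ys
count-↭ p = PP.↭-length ∘ PP.filter-↭ (T? ∘ p)

count-map : {A B : Set} (p : B → Bool) (f : A → B) (xs : List A) → count p (map f xs) ≡ count (p ∘ f) xs
count-map p f []       = refl
count-map p f (x ∷ xs) = trans (count-∷ p (f x) (map f xs))
  (trans (cong (_+_ (if p (f x) then 1 else 0)) (count-map p f xs)) (sym (count-∷ (p ∘ f) x xs)))

count-cong : {A : Set} {p q : A → Bool} (xs : List A) → (∀ {x} → x ∈ xs → p x ≡ q x) → count p xs ≡ count q xs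
count-cong {p = p} {q} []       _   = refl
count-cong {p = p} {q} (x ∷ xs) p≗q = trans (count-∷ p x xs)
  (trans (cong₂ (λ b n → (if b then 1 else 0) + n) (p≗q (here refl)) (count-cong xs (p≗q ∘ there)))
         (sym (count-∷ q x xs)))

fixedPositions : ℕ → List Bool → List ℕ
fixedPositions i []           = []
fixedPositions i (true ∷ bs)  = i ∷ fixedPositions (suc i) bs
fixedPositions i (false ∷ bs) = fixedPositions (suc i) bs

count-<-fixedPositions : ∀ i bs {w} → w ≤ i → count (_<ᵇ w) (fixedPositions i bs) ≡ 0
count-<-fixedPositions i []           w≤i = refl
count-<-fixedPositions i (true ∷ bs)  w≤i = trans (count-∷ _ i (fixedPositions (suc i) bs))
  (cong₂ (λ b n → (if b then 1 else 0) + n) (≥⇒<ᵇ-false i _ w≤i) (count-<-fixedPositions (suc i) bs (NP.m≤n⇒m≤1+n w≤i)))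
count-<-fixedPositions i (false ∷ bs) w≤i = count-<-fixedPositions (suc i) bs (NP.m≤n⇒m≤1+n w≤i)

count-insertFixedFrom : ∀ i bs (w : Word) u → falses bs ≡ length w →
  count (λ l → proj₁ l <ᵇ u) (insertFixedFrom i bs w) ≡ count (λ l → proj₁ l <ᵇ u) w + count (_<ᵇ u) (fixedPositions i bs)
count-insertFixedFrom i []           []      u _   = refl
count-insertFixedFrom i (true ∷ bs)  w       u len = begin
  count P ((i , 0) ∷ insertFixedFrom (suc i) bs w)
    ≡⟨ count-∷ P (i , 0) _ ⟩
  (if i <ᵇ u then 1 else 0) + count P (insertFixedFrom (suc i) bs w)
    ≡⟨ cong (_+_ (if i <ᵇ u then 1 else 0)) (count-insertFixedFrom (suc i) bs w u len) ⟩
  (if i <ᵇ u then 1 else 0) + (count P w + count (_<ᵇ u) (fixedPositions (suc i) bs))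
    ≡⟨ x∙yz≈y∙xz (if i <ᵇ u then 1 else 0) (count P w) (count (_<ᵇ u) (fixedPositions (suc i) bs)) ⟩
  count P w + ((if i <ᵇ u then 1 else 0) + count (_<ᵇ u) (fixedPositions (suc i) bs))
    ≡⟨ cong (_+_ (count P w)) (sym (count-∷ (_<ᵇ u) i (fixedPositions (suc i) bs))) ⟩
  count P w + count (_<ᵇ u) (fixedPositions i (true ∷ bs)) ∎
  where
  open ≡-Reasoning
  P : Letter → Bool
  P l = proj₁ l <ᵇ u
count-insertFixedFrom i (false ∷ bs) (l ∷ w) u len = begin
  count P (l ∷ insertFixedFrom (suc i) bs w)
    ≡⟨ count-∷ P l _ ⟩
  (if P l then 1 else 0) + count P (insertFixedFrom (suc i) bs w)
    ≡⟨ cong (_+_ (if P l then 1 else 0)) (count-insertFixedFrom (suc i) bs w u (NP.suc-injective len)) ⟩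
  (if P l then 1 else 0) + (count P w + count (_<ᵇ u) (fixedPositions (suc i) bs))
    ≡⟨ sym (NP.+-assoc (if P l then 1 else 0) _ _) ⟩
  (if P l then 1 else 0) + count P w + count (_<ᵇ u) (fixedPositions (suc i) bs)
    ≡⟨ cong (_+ count (_<ᵇ u) (fixedPositions (suc i) bs)) (sym (count-∷ P l w)) ⟩
  count P (l ∷ w) + count (_<ᵇ u) (fixedPositions (suc i) bs) ∎
  where
  open ≡-Reasoning
  P : Letter → Bool
  P l = proj₁ l <ᵇ u
count-insertFixedFrom i []           (_ ∷ _) u ()
count-insertFixedFrom i (false ∷ bs) []      u ()

invFixedLetter : ℕ → List Bool → Word → ℕ
invFixedLetter i []           w       = 0
invFixedLetter i (true ∷ bs)  w       = count (λ l → proj₁ l <ᵇ i) w + invFixedLetter (suc i) bs w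
invFixedLetter i (false ∷ bs) []      = 0
invFixedLetter i (false ∷ bs) (l ∷ w) = invFixedLetter (suc i) bs w

invLetterFixed : ℕ → List Bool → Word → ℕ
invLetterFixed i []           w       = 0
invLetterFixed i (true ∷ bs)  w       = invLetterFixed (suc i) bs w
invLetterFixed i (false ∷ bs) []      = 0
invLetterFixed i (false ∷ bs) (l ∷ w) = count (_<ᵇ proj₁ l) (fixedPositions (suc i) bs) + invLetterFixed (suc i) bs w

inv-insertFixedFrom : ∀ i bs (w : Word) → falses bs ≡ length w →
  inv (insertFixedFrom i bs w) ≡ inv w + invFixedLetter i bs w + invLetterFixed i bs w
inv-insertFixedFrom i []           []            _   = refl
inv-insertFixedFrom i (true ∷ bs)  w             len = begin
  count (λ l → proj₁ l <ᵇ i) (insertFixedFrom (suc i) bs w) + inv (insertFixedFrom (suc i) bs w)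
    ≡⟨ cong₂ _+_ (trans (count-insertFixedFrom (suc i) bs w i len)
                        (cong (_+_ C) (count-<-fixedPositions (suc i) bs (NP.n≤1+n i))))
                 (inv-insertFixedFrom (suc i) bs w len) ⟩
  (C + 0) + (inv w + invFixedLetter (suc i) bs w + invLetterFixed (suc i) bs w)
    ≡⟨ regroup C (inv w) _ _ ⟩
  inv w + (C + invFixedLetter (suc i) bs w) + invLetterFixed (suc i) bs w ∎
  where
  open ≡-Reasoning
  C = count (λ l → proj₁ l <ᵇ i) w
  regroup : ∀ c n f g → (c + 0) + (n + f + g) ≡ n + (c + f) + g
  regroup = ℕ-solve-∀
inv-insertFixedFrom i (false ∷ bs) ((v , t) ∷ w) len = begin
  count (λ l → proj₁ l <ᵇ v) (insertFixedFrom (suc i) bs w) + inv (insertFixedFrom (suc i) bs w)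
    ≡⟨ cong₂ _+_ (count-insertFixedFrom (suc i) bs w v len′) (inv-insertFixedFrom (suc i) bs w len′) ⟩
  (count (λ l → proj₁ l <ᵇ v) w + F) + (inv w + invFixedLetter (suc i) bs w + invLetterFixed (suc i) bs w)
    ≡⟨ regroup (count (λ l → proj₁ l <ᵇ v) w) F (inv w) _ _ ⟩
  (count (λ l → proj₁ l <ᵇ v) w + inv w) + invFixedLetter (suc i) bs w + (F + invLetterFixed (suc i) bs w) ∎
  where
  open ≡-Reasoning
  len′ = NP.suc-injective len
  F = count (_<ᵇ v) (fixedPositions (suc i) bs)
  regroup : ∀ c f n g h → (c + f) + (n + g + h) ≡ (c + n) + g + (f + h)
  regroup = ℕ-solve-∀
inv-insertFixedFrom i []           (_ ∷ _)       ()
inv-insertFixedFrom i (false ∷ bs) []            ()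

-- invLetterFixed regrouped by fixed points: each fixed point i counts the earlier letters
-- (accumulated in vs) above it.
invLetterFixedAcc : ℕ → List Bool → Word → List ℕ → ℕ
invLetterFixedAcc i []           w       vs = 0
invLetterFixedAcc i (true ∷ bs)  w       vs = count (i <ᵇ_) vs + invLetterFixedAcc (suc i) bs w vs
invLetterFixedAcc i (false ∷ bs) []      vs = 0
invLetterFixedAcc i (false ∷ bs) (l ∷ w) vs = invLetterFixedAcc (suc i) bs w (proj₁ l ∷ vs)

sum-count-∷ : ∀ i (ps vs : List ℕ) →
  sum (map (λ v → count (_<ᵇ v) (i ∷ ps)) vs) ≡ count (i <ᵇ_) vs + sum (map (λ v → count (_<ᵇ v) ps) vs)
sum-count-∷ i ps []       = refl
sum-count-∷ i ps (v ∷ vs) = begin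
  count (_<ᵇ v) (i ∷ ps) + sum (map (λ v → count (_<ᵇ v) (i ∷ ps)) vs)
    ≡⟨ cong₂ _+_ (count-∷ (_<ᵇ v) i ps) (sum-count-∷ i ps vs) ⟩
  ((if i <ᵇ v then 1 else 0) + count (_<ᵇ v) ps) + (count (i <ᵇ_) vs + sum (map (λ v → count (_<ᵇ v) ps) vs))
    ≡⟨ interchange (if i <ᵇ v then 1 else 0) (count (_<ᵇ v) ps) (count (i <ᵇ_) vs) (sum (map (λ v → count (_<ᵇ v) ps) vs)) ⟩
  ((if i <ᵇ v then 1 else 0) + count (i <ᵇ_) vs) + (count (_<ᵇ v) ps + sum (map (λ v → count (_<ᵇ v) ps) vs))
    ≡⟨ cong (_+ _) (sym (count-∷ (i <ᵇ_) v vs)) ⟩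
  count (i <ᵇ_) (v ∷ vs) + sum (map (λ v → count (_<ᵇ v) ps) (v ∷ vs)) ∎
  where open ≡-Reasoning

invLetterFixed≡Acc : ∀ i bs (w : Word) vs → falses bs ≡ length w →
  invLetterFixed i bs w + sum (map (λ v → count (_<ᵇ v) (fixedPositions i bs)) vs) ≡ invLetterFixedAcc i bs w vs
invLetterFixed≡Acc i []           w             []       _   = refl
invLetterFixed≡Acc i []           w             (v ∷ vs) len = invLetterFixed≡Acc i [] w vs len
invLetterFixed≡Acc i (true ∷ bs)  w             vs       len = begin
  invLetterFixed (suc i) bs w + sum (map (λ v → count (_<ᵇ v) (i ∷ fixedPositions (suc i) bs)) vs)
    ≡⟨ cong (_+_ (invLetterFixed (suc i) bs w)) (sum-count-∷ i (fixedPositions (suc i) bs) vs) ⟩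
  invLetterFixed (suc i) bs w + (count (i <ᵇ_) vs + sum (map (λ v → count (_<ᵇ v) (fixedPositions (suc i) bs)) vs))
    ≡⟨ x∙yz≈y∙xz (invLetterFixed (suc i) bs w) (count (i <ᵇ_) vs) (sum (map (λ v → count (_<ᵇ v) (fixedPositions (suc i) bs)) vs)) ⟩
  count (i <ᵇ_) vs + (invLetterFixed (suc i) bs w + sum (map (λ v → count (_<ᵇ v) (fixedPositions (suc i) bs)) vs))
    ≡⟨ cong (_+_ (count (i <ᵇ_) vs)) (invLetterFixed≡Acc (suc i) bs w vs len) ⟩
  invLetterFixedAcc i (true ∷ bs) w vs ∎
  where open ≡-Reasoning
invLetterFixed≡Acc i (false ∷ bs) ((v , t) ∷ w) vs len =
  trans (xy∙z≈y∙xz (count (_<ᵇ v) (fixedPositions (suc i) bs)) (invLetterFixed (suc i) bs w) _)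
        (invLetterFixed≡Acc (suc i) bs w (v ∷ vs) (NP.suc-injective len))
invLetterFixed≡Acc i (false ∷ bs) []            vs       ()

range : ℕ → ℕ → List ℕ
range s zero    = []
range s (suc k) = s ∷ range (suc s) k

∈-range⁻ : ∀ s k {v} → v ∈ range s k → s ≤ v × v < s + k
∈-range⁻ s (suc k) (here refl) = NP.≤-refl , subst (s <_) (sym (NP.+-suc s k)) (s≤s (NP.m≤m+n s k))
∈-range⁻ s (suc k) {v} (there v∈) with ∈-range⁻ (suc s) k v∈
... | s<v , v< = NP.<⇒≤ s<v , subst (v <_) (sym (NP.+-suc s k)) v<

count-≤-range : ∀ s k m → s ≤ m → m ≤ s + k → count (λ v → not (m <ᵇ v)) (range (suc s) k) ≡ m ∸ s
count-≤-range s zero m s≤m m≤ =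
  trans (sym (NP.n∸n≡0 s)) (cong (_∸ s) (sym (NP.≤-antisym (subst (m ≤_) (NP.+-identityʳ s) m≤) s≤m)))
count-≤-range s (suc k) m s≤m m≤ with NP.<-cmp s m
... | tri≈ _ refl _ = trans (count-∷ (λ v → not (m <ᵇ v)) (suc m) _)
  (trans (cong₂ (λ b n → (if not b then 1 else 0) + n) (<⇒<ᵇ-true m (suc m) (NP.n<1+n m)) (none (suc m) k (NP.n≤1+n m)))
         (sym (NP.n∸n≡0 m)))
  where
  none : ∀ s k → m ≤ s → count (λ v → not (m <ᵇ v)) (range (suc s) k) ≡ 0
  none s zero    _   = refl
  none s (suc k) m≤s = trans (count-∷ (λ v → not (m <ᵇ v)) (suc s) _)
    (cong₂ (λ b n → (if not b then 1 else 0) + n) (<⇒<ᵇ-true m (suc s) (s≤s m≤s)) (none (suc s) k (NP.m≤n⇒m≤1+n m≤s)))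
... | tri> _ _ m<s = ⊥-elim (NP.<⇒≱ m<s s≤m)
... | tri< s<m _ _ = trans (count-∷ (λ v → not (m <ᵇ v)) (suc s) _)
  (trans (cong₂ (λ b n → (if not b then 1 else 0) + n) (≥⇒<ᵇ-false m (suc s) s<m)
                (count-≤-range (suc s) k m s<m (subst (m ≤_) (NP.+-suc s k) m≤)))
         (sym (NP.+-∸-assoc 1 s<m)))

count-split : ∀ (vs : List ℕ) u → All (_≢ u) vs → count (u <ᵇ_) vs + count (_<ᵇ u) vs ≡ length vs
count-split []       u _          = refl
count-split (v ∷ vs) u (v≢u ∷ ≢u) with NP.<-cmp v u
... | tri≈ _ v≡u _ = ⊥-elim (v≢u v≡u)
... | tri< v<u _ _ = begin
  count (u <ᵇ_) (v ∷ vs) + count (_<ᵇ u) (v ∷ vs)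
    ≡⟨ cong₂ _+_ (trans (count-∷ (u <ᵇ_) v vs) (cong (λ b → (if b then 1 else 0) + count (u <ᵇ_) vs) (≥⇒<ᵇ-false u v (NP.<⇒≤ v<u))))
                 (trans (count-∷ (_<ᵇ u) v vs) (cong (λ b → (if b then 1 else 0) + count (_<ᵇ u) vs) (<⇒<ᵇ-true v u v<u))) ⟩
  count (u <ᵇ_) vs + suc (count (_<ᵇ u) vs)
    ≡⟨ NP.+-suc _ _ ⟩
  suc (count (u <ᵇ_) vs + count (_<ᵇ u) vs)
    ≡⟨ cong suc (count-split vs u ≢u) ⟩
  suc (length vs) ∎
  where open ≡-Reasoning
... | tri> _ _ u<v = begin
  count (u <ᵇ_) (v ∷ vs) + count (_<ᵇ u) (v ∷ vs)
    ≡⟨ cong₂ _+_ (trans (count-∷ (u <ᵇ_) v vs) (cong (λ b → (if b then 1 else 0) + count (u <ᵇ_) vs) (<⇒<ᵇ-true u v u<v)))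
                 (trans (count-∷ (_<ᵇ u) v vs) (cong (λ b → (if b then 1 else 0) + count (_<ᵇ u) vs) (≥⇒<ᵇ-false v u (NP.<⇒≤ u<v)))) ⟩
  suc (count (u <ᵇ_) vs + count (_<ᵇ u) vs)
    ≡⟨ cong suc (count-split vs u ≢u) ⟩
  suc (length vs) ∎
  where open ≡-Reasoning

NonFixedPosition : List Bool → ℕ → Set
NonFixedPosition bs v = Σ ℕ λ u → Σ (List Bool) λ rest → v ≡ suc u × drop u bs ≡ false ∷ rest

nthFalse-nonFixed : ∀ bs v → 1 ≤ v → v ≤ falses bs → NonFixedPosition bs (nthFalse bs v)
nthFalse-nonFixed []           v             1≤v v≤ = ⊥-elim (NP.<⇒≱ 1≤v v≤)
nthFalse-nonFixed (true ∷ bs)  v             1≤v v≤ with nthFalse-nonFixed bs v 1≤v v≤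
... | u , rest , eq , at = suc u , rest , cong suc eq , at
nthFalse-nonFixed (false ∷ bs) (suc zero)    _   _  = 0 , bs , refl , refl
nthFalse-nonFixed (false ∷ bs) (suc (suc v)) _   (s≤s v≤) with nthFalse-nonFixed bs (suc v) (s≤s z≤n) v≤
... | u , rest , eq , at = suc u , rest , cong suc eq , at

module InversionsOfInsertion (bs : List Bool) where
  k = falses bs

  nonFixed≢fixed : ∀ {p rest v} → drop p bs ≡ true ∷ rest → NonFixedPosition bs v → v ≢ suc p
  nonFixed≢fixed fixed (_ , _ , refl , at) refl with trans (sym fixed) at
  ... | ()

  -- A fixed point p has as many earlier letters above it as later letters below it: the
  -- letters have exactly the non-fixed positions as values.
  invFixedLetter≡Acc : ∀ p rest (w : Word) vs → Cursor bs p rest (length vs) →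
     (∀ u → count (_<ᵇ u) vs + count (λ l → proj₁ l <ᵇ u) w ≡ falsesBefore bs (pred u)) →
     All (NonFixedPosition bs) vs → All (NonFixedPosition bs) (map proj₁ w) → falses rest ≡ length w →
     invFixedLetter (suc p) rest w ≡ invLetterFixedAcc (suc p) rest w vs
  invFixedLetter≡Acc p []             w             vs _ _ _ _ _ = refl
  invFixedLetter≡Acc p (true ∷ rest)  w             vs cursor below nonFixedVs nonFixedW len =
    cong₂ _+_ later-below≡earlier-above
              (invFixedLetter≡Acc (suc p) rest w vs (cursor-true bs p cursor) below nonFixedVs nonFixedW len)
    where
    later-below≡earlier-above : count (λ l → proj₁ l <ᵇ suc p) w ≡ count (suc p <ᵇ_) vs
    later-below≡earlier-above = NP.+-cancelˡ-≡ (count (_<ᵇ suc p) vs) _ _ (begin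
      count (_<ᵇ suc p) vs + count (λ l → proj₁ l <ᵇ suc p) w  ≡⟨ below (suc p) ⟩
      falsesBefore bs p                                        ≡⟨ proj₂ cursor ⟩
      length vs                                                ≡⟨ sym (count-split vs (suc p) (All.map (nonFixed≢fixed (proj₁ cursor)) nonFixedVs)) ⟩
      count (suc p <ᵇ_) vs + count (_<ᵇ suc p) vs              ≡⟨ NP.+-comm (count (suc p <ᵇ_) vs) (count (_<ᵇ suc p) vs) ⟩
      count (_<ᵇ suc p) vs + count (suc p <ᵇ_) vs              ∎)
      where open ≡-Reasoning
  invFixedLetter≡Acc p (false ∷ rest) ((v , t) ∷ w) vs cursor below nonFixedVs (nonFixedV ∷ nonFixedW) len =
    invFixedLetter≡Acc (suc p) rest w (v ∷ vs) (cursor-false bs p cursor) below′ (nonFixedV ∷ nonFixedVs) nonFixedW (NP.suc-injective len)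
    where
    below′ : ∀ u → count (_<ᵇ u) (v ∷ vs) + count (λ l → proj₁ l <ᵇ u) w ≡ falsesBefore bs (pred u)
    below′ u = trans (cong (_+ count (λ l → proj₁ l <ᵇ u) w) (count-∷ (_<ᵇ u) v vs))
      (trans (xy∙z≈y∙xz (if v <ᵇ u then 1 else 0) (count (_<ᵇ u) vs) _)
      (trans (cong (_+_ (count (_<ᵇ u) vs)) (sym (count-∷ (λ l → proj₁ l <ᵇ u) (v , t) w))) (below u)))
  invFixedLetter≡Acc p (false ∷ rest) []            vs _ _ _ _ ()

  count-relabel : ∀ σ → map proj₁ σ ↭ range 1 k → ∀ u →
    count (λ l → proj₁ l <ᵇ u) (map (relabel bs) σ) ≡ falsesBefore bs (pred u)
  count-relabel σ perm u = begin
    count (λ l → proj₁ l <ᵇ u) (map (relabel bs) σ)  ≡⟨ count-map _ (relabel bs) σ ⟩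
    count (λ l → nthFalse bs (proj₁ l) <ᵇ u) σ       ≡⟨ sym (count-map (λ v → nthFalse bs v <ᵇ u) proj₁ σ) ⟩
    count (λ v → nthFalse bs v <ᵇ u) (map proj₁ σ)   ≡⟨ count-↭ _ perm ⟩
    count (λ v → nthFalse bs v <ᵇ u) (range 1 k)     ≡⟨ in-range u ⟩
    falsesBefore bs (pred u)                         ∎
    where
    open ≡-Reasoning
    none : (vs : List ℕ) → count (λ _ → false) vs ≡ 0
    none []       = refl
    none (_ ∷ vs) = none vs
    in-range : ∀ u → count (λ v → nthFalse bs v <ᵇ u) (range 1 k) ≡ falsesBefore bs (pred u)
    in-range zero    = trans (count-cong (range 1 k) (λ _ → refl)) (none (range 1 k))
    in-range (suc u) = trans
      (count-cong (range 1 k) λ {v} v∈ → let (1≤v , v<) = ∈-range⁻ 1 k v∈ in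
        trans (<ᵇ-suc (nthFalse bs v) u) (cong not (<ᵇ-nthFalse bs v u 1≤v (NP.<⇒≤pred v<))))
      (count-≤-range 0 k (falsesBefore bs u) z≤n (falsesBefore≤falses bs u))

  inv-relabel : ∀ σ → All (ValueIn k) σ → inv (map (relabel bs) σ) ≡ inv σ
  inv-relabel []            _            = refl
  inv-relabel ((v , t) ∷ σ) (val ∷ vals) = cong₂ _+_
    (trans (count-map (λ l → proj₁ l <ᵇ nthFalse bs v) (relabel bs) σ) (count-cong σ (λ {l} l∈ → order {l} (All.lookup vals l∈))))
    (inv-relabel σ vals)
    where
    order : ∀ {l} → ValueIn k l → (nthFalse bs (proj₁ l) <ᵇ nthFalse bs v) ≡ (proj₁ l <ᵇ v)
    order (1≤v′ , v′≤) = nthFalse-<ᵇ bs val (1≤v′ , v′≤)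

  inv-insertFixed : ∀ σ → All (ValueIn k) σ → map proj₁ σ ↭ range 1 k → k ≡ length σ →
    inv (insertFixed bs σ) ≡ inv σ + 2 * invFixedLetter 1 bs (map (relabel bs) σ)
  inv-insertFixed σ vals perm len = begin
    inv (insertFixedFrom 1 bs w)                         ≡⟨ inv-insertFixedFrom 1 bs w len′ ⟩
    inv w + invFixedLetter 1 bs w + invLetterFixed 1 bs w ≡⟨ cong₂ (λ m n → m + invFixedLetter 1 bs w + n) (inv-relabel σ vals) crossings ⟩
    inv σ + X + X                                         ≡⟨ double (inv σ) X ⟩
    inv σ + 2 * X                                         ∎
    where
    open ≡-Reasoning
    w = map (relabel bs) σ
    X = invFixedLetter 1 bs w
    len′ : falses bs ≡ length w
    len′ = trans len (sym (LP.length-map (relabel bs) σ))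
    nonFixedW : All (NonFixedPosition bs) (map proj₁ w)
    nonFixedW = subst (All (NonFixedPosition bs)) (LP.map-∘ {g = proj₁} {f = relabel bs} σ)
                      (AllP.map⁺ (All.map (λ { {v , t} (1≤v , v≤) → nthFalse-nonFixed bs v 1≤v v≤ }) vals))
    crossings : invLetterFixed 1 bs w ≡ X
    crossings = begin
      invLetterFixed 1 bs w        ≡⟨ sym (NP.+-identityʳ _) ⟩
      invLetterFixed 1 bs w + 0    ≡⟨ invLetterFixed≡Acc 1 bs w [] len′ ⟩
      invLetterFixedAcc 1 bs w []  ≡⟨ sym (invFixedLetter≡Acc 0 bs w [] (cursor-start bs) (count-relabel σ perm) [] nonFixedW len′) ⟩
      X                            ∎
    double : ∀ m x → m + x + x ≡ m + 2 * x
    double = ℕ-solve-∀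

All-reverse : {A : Set} {P : A → Set} (xs : List A) → All P xs → All P (reverse xs)
All-reverse xs all = All.tabulate (λ x∈ → All.lookup all (PP.∈-resp-↭ (PP.↭-reverse xs) x∈))

shuffles-falses : ∀ a b {bs} → bs ∈ shuffles a b → falses bs ≡ b
shuffles-falses zero    zero    (here refl) = refl
shuffles-falses zero    (suc b) p with MP.∈-map⁻ (false ∷_) p
... | _ , q , refl = cong suc (shuffles-falses zero b q)
shuffles-falses (suc a) zero    p with MP.∈-map⁻ (true ∷_) p
... | _ , q , refl = shuffles-falses a zero q
shuffles-falses (suc a) (suc b) p with MP.∈-++⁻ (map (true ∷_) (shuffles a (suc b))) p
... | inj₁ p₁ with MP.∈-map⁻ (true ∷_) p₁
...   | _ , q , refl = shuffles-falses a (suc b) q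
shuffles-falses (suc a) (suc b) p | inj₂ p₂ with MP.∈-map⁻ (false ∷_) p₂
...   | _ , q , refl = cong suc (shuffles-falses (suc a) b q)

sum-maj-insertFixed : ∀ x a σ → All (ValueIn (length σ)) σ → All (λ p → isFixed p ≡ false) (indexFrom 1 σ) →
  sumℤ (map (λ bs → x ^ℤ maj (insertFixed (reverse bs) σ)) (shuffles a (length σ))) ≡ x ^ℤ maj σ *ℤ qBinom x a (length σ)
sum-maj-insertFixed x a σ vals nonFixed = begin
  sumℤ (map (λ bs → x ^ℤ maj (insertFixed (reverse bs) σ)) (shuffles a k))
    ≡⟨ sumℤ-map-cong (shuffles a k) (λ {bs} bs∈ → cong (x ^ℤ_) (maj-insertFixed-reverse bs σ
         (subst (λ n → All (ValueIn n) σ) (sym (shuffles-falses a k bs∈)) vals) (shuffles-falses a k bs∈))) ⟩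
  shuffleSum a k (rankDown k (reverse σ))
    ≡⟨ shuffleSum-closed a k _ ranked ⟩
  x ^ℤ lettersComaj (rankDown k (reverse σ)) *ℤ qBinom x a k
    ≡⟨ cong (λ m → x ^ℤ m *ℤ qBinom x a k) (lettersComaj-rankDown σ) ⟩
  x ^ℤ maj σ *ℤ qBinom x a k ∎
  where
  open ≡-Reasoning
  open ShuffleSums x
  k = length σ
  ranked : Ranked k (rankDown k (reverse σ))
  ranked = rankDown-Ranked k (reverse σ) (LP.length-reverse σ)
    (subst (All AboveXorBelow) (reverse-indexFrom 0 σ) (All-reverse (indexFrom 1 σ) (All.map (λ {p} → nonFixed⇒AboveXorBelow {p}) nonFixed)))

-- Enumerating the fibre of dp

∈-remove : {A : Set} {x y : A} (us vs : List A) → y ∈ us ++ x ∷ vs → y ≢ x → y ∈ us ++ vs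
∈-remove []       vs (here y≡x) y≢x = ⊥-elim (y≢x y≡x)
∈-remove []       vs (there y∈) _   = y∈
∈-remove (u ∷ us) vs (here y≡u) _   = here y≡u
∈-remove (u ∷ us) vs (there y∈) y≢x = there (∈-remove us vs y∈ y≢x)

length-++-∷ : {A : Set} (us : List A) {x : A} (vs : List A) → length (us ++ x ∷ vs) ≡ suc (length (us ++ vs))
length-++-∷ us {x} vs = trans (LP.length-++ us) (trans (NP.+-suc (length us) (length vs)) (cong suc (sym (LP.length-++ us))))

Unique-⊆⇒length-≤ : {A : Set} (xs ys : List A) → Unique xs → (∀ {x} → x ∈ xs → x ∈ ys) → length xs ≤ length ys
Unique-⊆⇒length-≤ []       ys _            _  = z≤n
Unique-⊆⇒length-≤ (x ∷ xs) ys (x∉ ∷ uniq) xs⊆ with MP.∈-∃++ (xs⊆ (here refl))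
... | us , vs , refl = subst (suc (length xs) ≤_) (sym (length-++-∷ us vs))
  (s≤s (Unique-⊆⇒length-≤ xs (us ++ vs) uniq (λ x′∈ → ∈-remove us vs (xs⊆ (there x′∈)) (λ x′≡x → All.lookup x∉ x′∈ (sym x′≡x)))))

Unique-⊆-length⇒↭ : (xs ys : List ℕ) → Unique xs → Unique ys → (∀ {x} → x ∈ xs → x ∈ ys) → length xs ≡ length ys → xs ↭ ys
Unique-⊆-length⇒↭ xs ys uniq-xs uniq-ys xs⊆ len = ∼bag⇒↭ (unique∧set⇒bag uniq-xs uniq-ys (mk⇔ xs⊆ ys⊆))
  where
  ys⊆ : ∀ {y} → y ∈ ys → y ∈ xs
  ys⊆ {y} y∈ with y ∈? xs
  ... | yes y∈xs = y∈xs
  ... | no  y∉xs with MP.∈-∃++ y∈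
  ...   | us , vs , refl = ⊥-elim (NP.<⇒≱ (subst (length (us ++ vs) <_) (sym (length-++-∷ us vs)) (NP.n<1+n _))
                                          (subst (_≤ length (us ++ vs)) len shorter))
    where
    shorter : length xs ≤ length (us ++ vs)
    shorter = Unique-⊆⇒length-≤ xs (us ++ vs) uniq-xs (λ x∈ → ∈-remove us vs (xs⊆ x∈) (λ { refl → y∉xs x∈ }))

Unique-resp-↭ : {xs ys : List ℕ} → xs ↭ ys → Unique xs → Unique ys
Unique-resp-↭ = Unique-resp-↭ₛ ∘ ↭⇒↭ₛ

Unique-map-injectiveOn : {A B : Set} (f : A → B) (xs : List A) → Unique xs →
  (∀ {x y} → x ∈ xs → y ∈ xs → f x ≡ f y → x ≡ y) → Unique (map f xs)
Unique-map-injectiveOn f []       _             _   = []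
Unique-map-injectiveOn f (x ∷ xs) (x∉ ∷ uniq) inj =
  All.tabulate fx≢ ∷ Unique-map-injectiveOn f xs uniq (λ x∈ y∈ → inj (there x∈) (there y∈))
  where
  fx≢ : ∀ {z} → z ∈ map f xs → f x ≢ z
  fx≢ z∈ with MP.∈-map⁻ f z∈
  ... | y , y∈ , refl = All.lookup x∉ y∈ ∘ inj (here refl) (there y∈)

concatMap-map≡cartesianProductWith : {A B C : Set} (f : A → B → C) (xs : List A) (ys : List B) →
  concatMap (λ x → map (f x) ys) xs ≡ cartesianProductWith f xs ys
concatMap-map≡cartesianProductWith f []       ys = refl
concatMap-map≡cartesianProductWith f (x ∷ xs) ys = cong (map (f x) ys ++_) (concatMap-map≡cartesianProductWith f xs ys)

allWords-∈⁻ : {A : Set} (m : ℕ) (xs : List A) {w : List A} → w ∈ allWords m xs → length w ≡ m × All (_∈ xs) w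
allWords-∈⁻ zero    xs (here refl) = refl , []
allWords-∈⁻ (suc m) xs w∈ with MP.∈-cartesianProductWith⁻ _∷_ xs (allWords m xs)
                                 (subst (_ ∈_) (concatMap-map≡cartesianProductWith _∷_ xs (allWords m xs)) w∈)
... | x , w′ , x∈ , w′∈ , refl = map₂ (x∈ ∷_) (map₁ (cong suc) (allWords-∈⁻ m xs w′∈))

allWords-∈⁺ : {A : Set} (m : ℕ) (xs : List A) {w : List A} → length w ≡ m → All (_∈ xs) w → w ∈ allWords m xs
allWords-∈⁺ zero    xs {[]}    _   _            = here refl
allWords-∈⁺ (suc m) xs {x ∷ w} len (x∈ ∷ w⊆) =
  subst (_ ∈_) (sym (concatMap-map≡cartesianProductWith _∷_ xs (allWords m xs)))
        (MP.∈-cartesianProductWith⁺ _∷_ x∈ (allWords-∈⁺ m xs (NP.suc-injective len) w⊆))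

allWords-unique : {A : Set} (m : ℕ) (xs : List A) → Unique xs → Unique (allWords m xs)
allWords-unique zero    xs _    = [] ∷ []
allWords-unique (suc m) xs uniq =
  subst Unique (sym (concatMap-map≡cartesianProductWith _∷_ xs (allWords m xs)))
        (UP.cartesianProductWith⁺ _∷_ (λ { refl → refl , refl }) uniq (allWords-unique m xs uniq))

letters-∈⁻ : ∀ c n {v t} → (v , t) ∈ letters c n → 1 ≤ v × v ≤ n × t < c
letters-∈⁻ c n l∈ with MP.∈-cartesianProductWith⁻ (λ v t → (suc v , t)) (upTo n) (upTo c)
                         (subst (_ ∈_) (concatMap-map≡cartesianProductWith (λ v t → (suc v , t)) (upTo n) (upTo c)) l∈)
... | v , t , v∈ , t∈ , refl = s≤s z≤n , MP.∈-upTo⁻ v∈ , MP.∈-upTo⁻ t∈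

letters-∈⁺ : ∀ c n {v t} → 1 ≤ v → v ≤ n → t < c → (v , t) ∈ letters c n
letters-∈⁺ c n {suc v} _ v≤n t<c =
  subst (_ ∈_) (sym (concatMap-map≡cartesianProductWith (λ v t → (suc v , t)) (upTo n) (upTo c)))
        (MP.∈-cartesianProductWith⁺ (λ v t → (suc v , t)) (MP.∈-upTo⁺ v≤n) (MP.∈-upTo⁺ t<c))

letters-unique : ∀ c n → Unique (letters c n)
letters-unique c n =
  subst Unique (sym (concatMap-map≡cartesianProductWith (λ v t → (suc v , t)) (upTo n) (upTo c)))
        (UP.cartesianProductWith⁺ (λ v t → (suc v , t)) (λ { refl → refl , refl }) (UP.upTo⁺ n) (UP.upTo⁺ c))

trues : List Bool → ℕ
trues []           = 0
trues (true ∷ bs)  = suc (trues bs)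
trues (false ∷ bs) = trues bs

trues+falses : ∀ bs → trues bs + falses bs ≡ length bs
trues+falses []           = refl
trues+falses (true ∷ bs)  = cong suc (trues+falses bs)
trues+falses (false ∷ bs) = trans (NP.+-suc (trues bs) (falses bs)) (cong suc (trues+falses bs))

∈-shuffles⁺ : ∀ a b bs → trues bs ≡ a → falses bs ≡ b → bs ∈ shuffles a b
∈-shuffles⁺ zero    zero    []           refl refl = here refl
∈-shuffles⁺ (suc a) zero    (true ∷ bs)  t    f    = MP.∈-map⁺ (true ∷_) (∈-shuffles⁺ a zero bs (NP.suc-injective t) f)
∈-shuffles⁺ (suc a) (suc b) (true ∷ bs)  t    f    = MP.∈-++⁺ˡ (MP.∈-map⁺ (true ∷_) (∈-shuffles⁺ a (suc b) bs (NP.suc-injective t) f))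
∈-shuffles⁺ zero    (suc b) (false ∷ bs) t    f    = MP.∈-map⁺ (false ∷_) (∈-shuffles⁺ zero b bs t (NP.suc-injective f))
∈-shuffles⁺ (suc a) (suc b) (false ∷ bs) t    f    =
  MP.∈-++⁺ʳ (map (true ∷_) (shuffles a (suc b))) (MP.∈-map⁺ (false ∷_) (∈-shuffles⁺ (suc a) b bs t (NP.suc-injective f)))
∈-shuffles⁺ zero    b       (true ∷ bs)  ()   _
∈-shuffles⁺ a       zero    (false ∷ bs) _    ()

shuffles-unique : ∀ a b → Unique (shuffles a b)
shuffles-unique zero    zero    = [] ∷ []
shuffles-unique zero    (suc b) = UP.map⁺ LP.∷-injectiveʳ (shuffles-unique zero b)
shuffles-unique (suc a) zero    = UP.map⁺ LP.∷-injectiveʳ (shuffles-unique a zero)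
shuffles-unique (suc a) (suc b) =
  UP.++⁺ (UP.map⁺ LP.∷-injectiveʳ (shuffles-unique a (suc b))) (UP.map⁺ LP.∷-injectiveʳ (shuffles-unique (suc a) b)) disjoint
  where
  disjoint : ∀ {bs} → ¬ (bs ∈ map (true ∷_) (shuffles a (suc b)) × bs ∈ map (false ∷_) (shuffles (suc a) b))
  disjoint (∈₁ , ∈₂) with MP.∈-map⁻ (true ∷_) ∈₁ | MP.∈-map⁻ (false ∷_) ∈₂
  ... | _ , _ , refl | _ , _ , ()

≢⇒≡ᵇ-false : ∀ m n → m ≢ n → (m ≡ᵇ n) ≡ false
≢⇒≡ᵇ-false m n m≢n with m ≡ᵇ n in eq
... | false = refl
... | true  = ⊥-elim (m≢n (NP.≡ᵇ⇒≡ m n (subst T (sym eq) tt)))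

T⇒≡true : ∀ {b} → T b → b ≡ true
T⇒≡true {true} _ = refl

distinctVals⇒Unique : ∀ w → distinctVals w ≡ true → Unique (map proj₁ w)
distinctVals⇒Unique []            _        = []
distinctVals⇒Unique ((v , t) ∷ w) distinct with all (λ l → not (proj₁ l ≡ᵇ v)) w in fresh
... | true = All.tabulate v≢ ∷ distinctVals⇒Unique w distinct
  where
  v≢ : ∀ {u} → u ∈ map proj₁ w → v ≢ u
  v≢ u∈ refl with MP.∈-map⁻ proj₁ u∈
  ... | l , l∈ , refl with trans (sym (T⇒≡true (All.lookup (AllP.all⁺ _ w (subst T (sym fresh) tt)) l∈))) (cong not (≡ᵇ-refl (proj₁ l)))
  ...   | ()

Unique⇒distinctVals : ∀ w → Unique (map proj₁ w) → distinctVals w ≡ true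
Unique⇒distinctVals []            _             = refl
Unique⇒distinctVals ((v , t) ∷ w) (v∉ ∷ uniq) =
  cong₂ _∧_ (T⇒≡true (AllP.all⁻ _ (All.tabulate fresh))) (Unique⇒distinctVals w uniq)
  where
  fresh : ∀ {l} → l ∈ w → T (not (proj₁ l ≡ᵇ v))
  fresh {l} l∈ = subst T (sym (cong not (≢⇒≡ᵇ-false (proj₁ l) v (λ l≡v → All.lookup v∉ (MP.∈-map⁺ proj₁ l∈) (sym l≡v))))) tt

range-suc : ∀ s k → range (suc s) k ≡ map suc (range s k)
range-suc s zero    = refl
range-suc s (suc k) = cong (suc s ∷_) (range-suc (suc s) k)

length-range : ∀ s k → length (range s k) ≡ k
length-range s zero    = refl
length-range s (suc k) = cong suc (length-range (suc s) k)

∈-range⁺ : ∀ s k {v} → s ≤ v → v < s + k → v ∈ range s k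
∈-range⁺ s zero    s≤v v< = ⊥-elim (NP.<⇒≱ v< (subst (_≤ _) (sym (NP.+-identityʳ s)) s≤v))
∈-range⁺ s (suc k) {v} s≤v v< with NP.<-cmp s v
... | tri≈ _ refl _ = here refl
... | tri< s<v _ _ = there (∈-range⁺ (suc s) k s<v (subst (v <_) (NP.+-suc s k) v<))
... | tri> _ _ v<s = ⊥-elim (NP.<⇒≱ v<s s≤v)

range-unique : ∀ s k → Unique (range s k)
range-unique s zero    = []
range-unique s (suc k) = All.tabulate (λ v∈ → NP.<⇒≢ (proj₁ (∈-range⁻ (suc s) k v∈))) ∷ range-unique (suc s) k

count-<-range : ∀ k v → 1 ≤ v → v ≤ k → count (_<ᵇ v) (range 1 k) ≡ pred v
count-<-range k (suc v) _ v≤k =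
  trans (count-cong (range 1 k) (λ {u} _ → <ᵇ-suc u v)) (count-≤-range 0 k v z≤n (NP.<⇒≤ v≤k))

nonFixedPositions : ℕ → List Bool → List ℕ
nonFixedPositions i []           = []
nonFixedPositions i (true ∷ bs)  = nonFixedPositions (suc i) bs
nonFixedPositions i (false ∷ bs) = i ∷ nonFixedPositions (suc i) bs

fixed++nonFixed↭range : ∀ i bs → fixedPositions i bs ++ nonFixedPositions i bs ↭ range i (length bs)
fixed++nonFixed↭range i []           = ↭-refl
fixed++nonFixed↭range i (true ∷ bs)  = ↭-prep i (fixed++nonFixed↭range (suc i) bs)
fixed++nonFixed↭range i (false ∷ bs) =
  ↭-trans (PP.shift i (fixedPositions (suc i) bs) (nonFixedPositions (suc i) bs)) (↭-prep i (fixed++nonFixed↭range (suc i) bs))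

nonFixedPositions-suc : ∀ i bs → nonFixedPositions (suc i) bs ≡ map suc (nonFixedPositions i bs)
nonFixedPositions-suc i []           = refl
nonFixedPositions-suc i (true ∷ bs)  = nonFixedPositions-suc (suc i) bs
nonFixedPositions-suc i (false ∷ bs) = cong (suc i ∷_) (nonFixedPositions-suc (suc i) bs)

map-nthFalse-range : ∀ bs → map (nthFalse bs) (range 1 (falses bs)) ≡ nonFixedPositions 1 bs
map-nthFalse-range []           = refl
map-nthFalse-range (true ∷ bs)  =
  trans (LP.map-∘ (range 1 (falses bs))) (trans (cong (map suc) (map-nthFalse-range bs)) (sym (nonFixedPositions-suc 1 bs)))
map-nthFalse-range (false ∷ bs) = cong (1 ∷_) (begin
  map (nthFalse (false ∷ bs)) (range 2 (falses bs))          ≡⟨ cong (map (nthFalse (false ∷ bs))) (range-suc 1 (falses bs)) ⟩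
  map (nthFalse (false ∷ bs)) (map suc (range 1 (falses bs))) ≡⟨ sym (LP.map-∘ (range 1 (falses bs))) ⟩
  map (nthFalse (false ∷ bs) ∘ suc) (range 1 (falses bs))     ≡⟨ LP.map-cong-local (All.tabulate shift) ⟩
  map (suc ∘ nthFalse bs) (range 1 (falses bs))               ≡⟨ LP.map-∘ (range 1 (falses bs)) ⟩
  map suc (map (nthFalse bs) (range 1 (falses bs)))           ≡⟨ cong (map suc) (map-nthFalse-range bs) ⟩
  map suc (nonFixedPositions 1 bs)                            ≡⟨ sym (nonFixedPositions-suc 1 bs) ⟩
  nonFixedPositions 2 bs                                      ∎)
  where
  open ≡-Reasoning
  shift : ∀ {v} → v ∈ range 1 (falses bs) → nthFalse (false ∷ bs) (suc v) ≡ suc (nthFalse bs v)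
  shift {suc v} _  = refl
  shift {zero}  0∈ with () ← proj₁ (∈-range⁻ 1 (falses bs) 0∈)

nonFixedPositions-≥ : ∀ i bs → All (i ≤_) (nonFixedPositions i bs)
nonFixedPositions-≥ i []           = []
nonFixedPositions-≥ i (true ∷ bs)  = All.map (NP.≤-trans (NP.n≤1+n i)) (nonFixedPositions-≥ (suc i) bs)
nonFixedPositions-≥ i (false ∷ bs) = NP.≤-refl ∷ All.map (NP.≤-trans (NP.n≤1+n i)) (nonFixedPositions-≥ (suc i) bs)

count-<-all-≥ : ∀ u (vs : List ℕ) → All (u ≤_) vs → count (_<ᵇ u) vs ≡ 0
count-<-all-≥ u []       _           = refl
count-<-all-≥ u (v ∷ vs) (u≤v ∷ u≤) =
  trans (count-∷ (_<ᵇ u) v vs) (cong₂ (λ b n → (if b then 1 else 0) + n) (≥⇒<ᵇ-false v u u≤v) (count-<-all-≥ u vs u≤))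

count-<-nonFixedPositions : ∀ s bs p → count (_<ᵇ suc (s + p)) (nonFixedPositions (suc s) bs) ≡ falsesBefore bs p
count-<-nonFixedPositions s []           zero    = refl
count-<-nonFixedPositions s []           (suc p) = refl
count-<-nonFixedPositions s (b ∷ bs)     zero    = trans
  (cong (λ m → count (_<ᵇ suc m) (nonFixedPositions (suc s) (b ∷ bs))) (NP.+-identityʳ s))
  (count-<-all-≥ (suc s) _ (nonFixedPositions-≥ (suc s) (b ∷ bs)))
count-<-nonFixedPositions s (true ∷ bs)  (suc p) = trans
  (cong (λ m → count (_<ᵇ suc m) (nonFixedPositions (2 + s) bs)) (NP.+-suc s p))
  (count-<-nonFixedPositions (suc s) bs p)
count-<-nonFixedPositions s (false ∷ bs) (suc p) = trans (count-∷ (_<ᵇ suc (s + suc p)) (suc s) _)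
  (cong₂ (λ b n → (if b then 1 else 0) + n)
         (<⇒<ᵇ-true (suc s) (suc (s + suc p)) (s≤s (subst (suc s ≤_) (sym (NP.+-suc s p)) (s≤s (NP.m≤m+n s p)))))
         (trans (cong (λ m → count (_<ᵇ suc m) (nonFixedPositions (2 + s) bs)) (NP.+-suc s p))
                (count-<-nonFixedPositions (suc s) bs p)))

∈-nonFixedPositions⁻ : ∀ s bs {u} → u ∈ nonFixedPositions (suc s) bs →
  Σ ℕ λ p → Σ (List Bool) λ rest → u ≡ suc (s + p) × drop p bs ≡ false ∷ rest
∈-nonFixedPositions⁻ s []           ()
∈-nonFixedPositions⁻ s (true ∷ bs)  u∈ with ∈-nonFixedPositions⁻ (suc s) bs u∈
... | p , rest , refl , at = suc p , rest , cong suc (sym (NP.+-suc s p)) , at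
∈-nonFixedPositions⁻ s (false ∷ bs) (here refl) = 0 , bs , cong suc (sym (NP.+-identityʳ s)) , refl
∈-nonFixedPositions⁻ s (false ∷ bs) (there u∈) with ∈-nonFixedPositions⁻ (suc s) bs u∈
... | p , rest , refl , at = suc p , rest , cong suc (sym (NP.+-suc s p)) , at

nthFalse-at : ∀ bs p {rest} → drop p bs ≡ false ∷ rest → nthFalse bs (suc (falsesBefore bs p)) ≡ suc p
nthFalse-at (false ∷ bs) zero    refl = refl
nthFalse-at (true ∷ bs)  (suc p) at   = cong suc (nthFalse-at bs p at)
nthFalse-at (false ∷ bs) (suc p) at   = cong suc (nthFalse-at bs p at)
nthFalse-at []           (suc p) ()
nthFalse-at (true ∷ bs)  zero    ()

nthFalse-injective : ∀ bs {v v′} → ValueIn (falses bs) (v , 0) → ValueIn (falses bs) (v′ , 0) →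
  (nthFalse bs v ≡ᵇ nthFalse bs v′) ≡ (v ≡ᵇ v′)
nthFalse-injective bs {v} {v′} val val′ with NP.<-cmp v v′
... | tri≈ _ refl _ = trans (≡ᵇ-refl (nthFalse bs v)) (sym (≡ᵇ-refl v))
... | tri< v<v′ _ _ = trans (≢⇒≡ᵇ-false f f′ (NP.<⇒≢ (<ᵇ-true⇒< f f′ (trans (nthFalse-<ᵇ bs val′ val) (<⇒<ᵇ-true v v′ v<v′)))))
                            (sym (≢⇒≡ᵇ-false v v′ (NP.<⇒≢ v<v′)))
  where
  f  = nthFalse bs v
  f′ = nthFalse bs v′
... | tri> _ _ v′<v = trans (≢⇒≡ᵇ-false f f′ (≢-sym (NP.<⇒≢ (<ᵇ-true⇒< f′ f (trans (nthFalse-<ᵇ bs val val′) (<⇒<ᵇ-true v′ v v′<v))))))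
                            (sym (≢⇒≡ᵇ-false v v′ (≢-sym (NP.<⇒≢ v′<v))))
  where
  f  = nthFalse bs v
  f′ = nthFalse bs v′

values-insertFixedFrom : ∀ i bs (w : Word) → falses bs ≡ length w →
  map proj₁ (insertFixedFrom i bs w) ↭ fixedPositions i bs ++ map proj₁ w
values-insertFixedFrom i []           []      _   = ↭-refl
values-insertFixedFrom i (true ∷ bs)  w       len = ↭-prep i (values-insertFixedFrom (suc i) bs w len)
values-insertFixedFrom i (false ∷ bs) (l ∷ w) len =
  ↭-trans (↭-prep (proj₁ l) (values-insertFixedFrom (suc i) bs w (NP.suc-injective len)))
          (↭-sym (PP.shift (proj₁ l) (fixedPositions (suc i) bs) (map proj₁ w)))
values-insertFixedFrom i []           (_ ∷ _) ()
values-insertFixedFrom i (false ∷ bs) []      ()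

length-insertFixedFrom : ∀ i bs (w : Word) → falses bs ≡ length w → length (insertFixedFrom i bs w) ≡ length bs
length-insertFixedFrom i []           []      _   = refl
length-insertFixedFrom i (true ∷ bs)  w       len = cong suc (length-insertFixedFrom (suc i) bs w len)
length-insertFixedFrom i (false ∷ bs) (_ ∷ w) len = cong suc (length-insertFixedFrom (suc i) bs w (NP.suc-injective len))
length-insertFixedFrom i []           (_ ∷ _) ()
length-insertFixedFrom i (false ∷ bs) []      ()

col-insertFixedFrom : ∀ i bs (w : Word) → falses bs ≡ length w → col (insertFixedFrom i bs w) ≡ col w
col-insertFixedFrom i []           []            _   = refl
col-insertFixedFrom i (true ∷ bs)  w             len = col-insertFixedFrom (suc i) bs w len
col-insertFixedFrom i (false ∷ bs) ((_ , t) ∷ w) len = cong (_+_ t) (col-insertFixedFrom (suc i) bs w (NP.suc-injective len))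
col-insertFixedFrom i []           (_ ∷ _)       ()
col-insertFixedFrom i (false ∷ bs) []            ()

All-insertFixedFrom : {P : Letter → Set} → ∀ i bs (w : Word) →
  All (λ p → P (p , 0)) (fixedPositions i bs) → All P w → All P (insertFixedFrom i bs w)
All-insertFixedFrom i []           w       _              _          = []
All-insertFixedFrom i (true ∷ bs)  w       (fixed ∷ fixeds) letters = fixed ∷ All-insertFixedFrom (suc i) bs w fixeds letters
All-insertFixedFrom i (false ∷ bs) []      _              _          = []
All-insertFixedFrom i (false ∷ bs) (_ ∷ w) fixeds (letter ∷ letters) = letter ∷ All-insertFixedFrom (suc i) bs w fixeds letters

col-relabel : ∀ bs (σ : Word) → col (map (relabel bs) σ) ≡ col σ
col-relabel bs []            = refl
col-relabel bs ((_ , t) ∷ σ) = cong (_+_ t) (col-relabel bs σ)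

nonFixedᵇ : ℕ × Letter → Bool
nonFixedᵇ p = not (isFixed p)

fixedPattern : Word → List Bool
fixedPattern π = map isFixed (indexFrom 1 π)

nonFixedLetters : Word → Word
nonFixedLetters π = map proj₂ (filterᵇ nonFixedᵇ (indexFrom 1 π))

record IsDerangement (c : ℕ) (σ : Word) : Set where
  field
    values   : All (ValueIn (length σ)) σ
    colours  : All (λ l → proj₂ l < c) σ
    permutes : map proj₁ σ ↭ range 1 (length σ)
    noFixed  : All (λ p → isFixed p ≡ false) (indexFrom 1 σ)

module Insertion {c : ℕ} {σ : Word} (der : IsDerangement c σ) (bs : List Bool) (len : falses bs ≡ length σ) where
  open IsDerangement der

  k = falses bs
  w = map (relabel bs) σ

  values′ : All (ValueIn k) σ
  values′ = subst (λ n → All (ValueIn n) σ) (sym len) values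

  permutes′ : map proj₁ σ ↭ range 1 k
  permutes′ = subst (λ n → map proj₁ σ ↭ range 1 n) (sym len) permutes

  length-w : falses bs ≡ length w
  length-w = trans len (sym (LP.length-map (relabel bs) σ))

  col-insertFixed : col (insertFixed bs σ) ≡ col σ
  col-insertFixed = trans (col-insertFixedFrom 1 bs w length-w) (col-relabel bs σ)

  inv-insertFixed : inv (insertFixed bs σ) ≡ inv σ + 2 * invFixedLetter 1 bs w
  inv-insertFixed = InversionsOfInsertion.inv-insertFixed bs σ values′ permutes′ len

  decompose : ∀ p rest r τ → Cursor bs p rest r → All (ValueIn k) τ → All (λ q → isFixed q ≡ false) (indexFrom (suc r) τ) →
    falses rest ≡ length τ →
    map isFixed (indexFrom (suc p) (insertFixedFrom (suc p) rest (map (relabel bs) τ))) ≡ rest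
      × map proj₂ (filterᵇ nonFixedᵇ (indexFrom (suc p) (insertFixedFrom (suc p) rest (map (relabel bs) τ)))) ≡ map (relabel bs) τ
  decompose p []             r []            _      _            _                _   = refl , refl
  decompose p (true ∷ rest)  r τ             cursor vals         noFixedτ         len′
    with decompose (suc p) rest r τ (cursor-true bs p cursor) vals noFixedτ len′
  ... | fixeds , letters =
    cong₂ _∷_ fixed fixeds , trans (cong (map proj₂) (LP.filter-reject (T? ∘ nonFixedᵇ) {x = suc p , (suc p , 0)} {xs = indexFrom (2 + p) (insertFixedFrom (2 + p) rest (map (relabel bs) τ))} (subst T (cong not fixed)))) letters
    where
    fixed : isFixed (suc p , (suc p , 0)) ≡ true
    fixed = cong (_∧ true) (≡ᵇ-refl p)
  decompose p (false ∷ rest) r ((v , t) ∷ τ) cursor (val ∷ vals) (notFixed ∷ noFixedτ) len′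
    with decompose (suc p) rest (suc r) τ (cursor-false bs p cursor) vals noFixedτ (NP.suc-injective len′)
  ... | fixeds , letters =
    cong₂ _∷_ nonFixed fixeds ,
    trans (cong (map proj₂) (LP.filter-accept (T? ∘ nonFixedᵇ) {x = suc p , (nthFalse bs v , t)} {xs = indexFrom (2 + p) (insertFixedFrom (2 + p) rest (map (relabel bs) τ))} (subst T (sym (cong not nonFixed)) tt))) (cong ((nthFalse bs v , t) ∷_) letters)
    where
    at : nthFalse bs (suc r) ≡ suc p
    at = trans (cong (nthFalse bs ∘ suc) (sym (proj₂ cursor))) (nthFalse-at bs p (proj₁ cursor))
    rank≤k : suc r ≤ k
    rank≤k = subst (_≤ k) (proj₂ (cursor-false bs p cursor)) (falsesBefore≤falses bs (suc p))
    nonFixed : isFixed (suc p , (nthFalse bs v , t)) ≡ false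
    nonFixed = begin
      (nthFalse bs v ≡ᵇ suc p) ∧ (t ≡ᵇ 0)                ≡⟨ cong (λ n → (nthFalse bs v ≡ᵇ n) ∧ (t ≡ᵇ 0)) (sym at) ⟩
      (nthFalse bs v ≡ᵇ nthFalse bs (suc r)) ∧ (t ≡ᵇ 0)  ≡⟨ cong (_∧ (t ≡ᵇ 0)) (nthFalse-injective bs val (s≤s z≤n , rank≤k)) ⟩
      (v ≡ᵇ suc r) ∧ (t ≡ᵇ 0)                            ≡⟨ notFixed ⟩
      false                                              ∎
      where open ≡-Reasoning
  decompose p []             r (_ ∷ _)       _ _ _ ()
  decompose p (false ∷ rest) r []            _ _ _ ()

  fixedPattern-insertFixed : fixedPattern (insertFixed bs σ) ≡ bs
  fixedPattern-insertFixed = proj₁ (decompose 0 bs 0 σ (cursor-start bs) values′ noFixed len)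

  nonFixedLetters-insertFixed : nonFixedLetters (insertFixed bs σ) ≡ w
  nonFixedLetters-insertFixed = proj₂ (decompose 0 bs 0 σ (cursor-start bs) values′ noFixed len)

  dp-insertFixed : dp (insertFixed bs σ) ≡ σ
  dp-insertFixed = begin
    map (standardise (nonFixedLetters (insertFixed bs σ))) (nonFixedLetters (insertFixed bs σ))
      ≡⟨ cong (λ ls → map (standardise ls) ls) nonFixedLetters-insertFixed ⟩
    map (standardise w) w                        ≡⟨ sym (LP.map-∘ σ) ⟩
    map (standardise w ∘ relabel bs) σ           ≡⟨ LP.map-id-local (All.map standardise-relabel values′) ⟩
    σ                                            ∎
    where
    open ≡-Reasoning
    standardise : Word → Letter → Letter
    standardise ls l = suc (count (λ m → proj₁ m <ᵇ proj₁ l) ls) , proj₂ l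
    standardise-relabel : ∀ {l} → ValueIn k l → standardise w (relabel bs l) ≡ l
    standardise-relabel {suc v , t} (1≤v , v≤k) = cong (_, t) (begin
      suc (count (λ m → proj₁ m <ᵇ nthFalse bs (suc v)) w)            ≡⟨ cong suc (count-map _ (relabel bs) σ) ⟩
      suc (count (λ m → nthFalse bs (proj₁ m) <ᵇ nthFalse bs (suc v)) σ)
        ≡⟨ cong suc (count-cong σ (λ m∈ → nthFalse-<ᵇ bs (1≤v , v≤k) (All.lookup values′ m∈))) ⟩
      suc (count (λ m → proj₁ m <ᵇ suc v) σ)                          ≡⟨ cong suc (sym (count-map (_<ᵇ suc v) proj₁ σ)) ⟩
      suc (count (_<ᵇ suc v) (map proj₁ σ))                           ≡⟨ cong suc (count-↭ _ permutes′) ⟩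
      suc (count (_<ᵇ suc v) (range 1 k))                             ≡⟨ cong suc (count-<-range k (suc v) 1≤v v≤k) ⟩
      suc v                                                           ∎)

  values-relabel : map proj₁ w ↭ nonFixedPositions 1 bs
  values-relabel = subst₂ _↭_ (trans (sym (LP.map-∘ {g = nthFalse bs} {f = proj₁} σ)) (LP.map-∘ {g = proj₁} {f = relabel bs} σ))
                             (map-nthFalse-range bs) (PP.map⁺ (nthFalse bs) permutes′)

  fixedPositions⊆range : ∀ {u} → u ∈ fixedPositions 1 bs → u ∈ range 1 (length bs)
  fixedPositions⊆range = PP.∈-resp-↭ (fixed++nonFixed↭range 1 bs) ∘ MP.∈-++⁺ˡ

  nonFixedPositions⊆range : ∀ {u} → u ∈ nonFixedPositions 1 bs → u ∈ range 1 (length bs)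
  nonFixedPositions⊆range = PP.∈-resp-↭ (fixed++nonFixed↭range 1 bs) ∘ MP.∈-++⁺ʳ (fixedPositions 1 bs)

  values-insertFixed : map proj₁ (insertFixed bs σ) ↭ range 1 (length bs)
  values-insertFixed = ↭-trans (values-insertFixedFrom 1 bs w length-w)
                               (↭-trans (PP.++⁺ˡ (fixedPositions 1 bs) values-relabel) (fixed++nonFixed↭range 1 bs))

  insertFixed∈G : ∀ {n} → 1 ≤ c → length bs ≡ n → insertFixed bs σ ∈ G c n
  insertFixed∈G {n} 1≤c len-bs = MP.∈-filter⁺ (T? ∘ distinctVals) ∈allWords distinct
    where
    in-range : ∀ {u} → u ∈ range 1 (length bs) → 1 ≤ u × u ≤ n
    in-range {u} u∈ with ∈-range⁻ 1 (length bs) u∈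
    ... | 1≤u , s≤s u≤ = 1≤u , subst (u ≤_) len-bs u≤
    letter∈ : ∀ {l} → ValueIn k l → proj₂ l < c → relabel bs l ∈ letters c n
    letter∈ {v , t} (1≤v , v≤k) t<c =
      let (1≤u , u≤n) = in-range (nonFixedPositions⊆range (subst (nthFalse bs v ∈_) (map-nthFalse-range bs)
                                   (MP.∈-map⁺ (nthFalse bs) (∈-range⁺ 1 k 1≤v (s≤s v≤k)))))
      in letters-∈⁺ c n 1≤u u≤n t<c
    ∈allWords : insertFixed bs σ ∈ allWords n (letters c n)
    ∈allWords = allWords-∈⁺ n (letters c n) (trans (length-insertFixedFrom 1 bs w length-w) len-bs)
      (All-insertFixedFrom 1 bs w (All.tabulate (λ u∈ → let (1≤u , u≤n) = in-range (fixedPositions⊆range u∈) in letters-∈⁺ c n 1≤u u≤n 1≤c))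
                                  (AllP.map⁺ (All.tabulate (λ l∈ → letter∈ (All.lookup values′ l∈) (All.lookup colours l∈)))))
    distinct : T (distinctVals (insertFixed bs σ))
    distinct = subst T (sym (Unique⇒distinctVals (insertFixed bs σ) (Unique-resp-↭ (↭-sym values-insertFixed) (range-unique 1 (length bs))))) tt

isFixed⇒≡ : ∀ {i v t} → isFixed (i , (v , t)) ≡ true → (i , 0) ≡ (v , t)
isFixed⇒≡ {i} {v} {t} fixed with v ≡ᵇ i in v≡i | t ≡ᵇ 0 in t≡0
... | true  | true  = cong₂ _,_ (sym (NP.≡ᵇ⇒≡ v i (subst T (sym v≡i) tt))) (sym (NP.≡ᵇ⇒≡ t 0 (subst T (sym t≡0) tt)))
... | true  | false = case fixed of λ ()
... | false | _     = case fixed of λ ()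

insertFixedFrom-decomposition : ∀ i (π : Word) →
  insertFixedFrom i (map isFixed (indexFrom i π)) (map proj₂ (filterᵇ nonFixedᵇ (indexFrom i π))) ≡ π
insertFixedFrom-decomposition i []            = refl
insertFixedFrom-decomposition i ((v , t) ∷ π) with isFixed (i , (v , t)) in fixed
... | false = cong ((v , t) ∷_) (insertFixedFrom-decomposition (suc i) π)
... | true  = cong₂ _∷_ (isFixed⇒≡ fixed) (insertFixedFrom-decomposition (suc i) π)

++-cancelˡ-↭ : {A : Set} (xs : List A) {ys zs : List A} → xs ++ ys ↭ xs ++ zs → ys ↭ zs
++-cancelˡ-↭ []       p = p
++-cancelˡ-↭ (x ∷ xs) p = ++-cancelˡ-↭ xs (PP.drop-∷ p)

∈G⁻ : ∀ {c n π} → π ∈ G c n → length π ≡ n × All (_∈ letters c n) π × map proj₁ π ↭ range 1 n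
∈G⁻ {c} {n} {π} π∈G with MP.∈-filter⁻ (T? ∘ distinctVals) {xs = allWords n (letters c n)} π∈G
... | π∈allWords , distinct with allWords-∈⁻ n (letters c n) π∈allWords
...   | length-π , π⊆letters = length-π , π⊆letters ,
  Unique-⊆-length⇒↭ (map proj₁ π) (range 1 n) (distinctVals⇒Unique π (T⇒≡true distinct)) (range-unique 1 n) ⊆range
                    (trans (LP.length-map proj₁ π) (trans length-π (sym (length-range 1 n))))
  where
  ⊆range : ∀ {u} → u ∈ map proj₁ π → u ∈ range 1 n
  ⊆range u∈ with MP.∈-map⁻ proj₁ u∈
  ... | _ , l∈ , refl = let (1≤v , v≤n , _) = letters-∈⁻ c n (All.lookup π⊆letters l∈) in ∈-range⁺ 1 n 1≤v (s≤s v≤n)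

falses-fixedPattern : ∀ π → falses (fixedPattern π) ≡ length (nonFixedLetters π)
falses-fixedPattern π = trans (falses-map-isFixed (indexFrom 1 π)) (sym (LP.length-map proj₂ (filterᵇ nonFixedᵇ (indexFrom 1 π))))
  where
  falses-map-isFixed : ∀ (ps : List (ℕ × Letter)) → falses (map isFixed ps) ≡ length (filterᵇ nonFixedᵇ ps)
  falses-map-isFixed []       = refl
  falses-map-isFixed (p ∷ ps) with isFixed p
  ... | true  = falses-map-isFixed ps
  ... | false = cong suc (falses-map-isFixed ps)

values-nonFixedLetters : ∀ {c n π} → π ∈ G c n → map proj₁ (nonFixedLetters π) ↭ nonFixedPositions 1 (fixedPattern π)
values-nonFixedLetters {c} {n} {π} π∈G = ++-cancelˡ-↭ (fixedPositions 1 bs) (begin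
  fixedPositions 1 bs ++ map proj₁ ls            ↭⟨ ↭-sym (values-insertFixedFrom 1 bs ls (falses-fixedPattern π)) ⟩
  map proj₁ (insertFixedFrom 1 bs ls)            ≡⟨ cong (map proj₁) (insertFixedFrom-decomposition 1 π) ⟩
  map proj₁ π                                    ↭⟨ proj₂ (proj₂ (∈G⁻ {c} {n} π∈G)) ⟩
  range 1 n                                      ≡⟨ cong (range 1) (sym length-bs) ⟩
  range 1 (length bs)                            ↭⟨ ↭-sym (fixed++nonFixed↭range 1 bs) ⟩
  fixedPositions 1 bs ++ nonFixedPositions 1 bs  ∎)
  where
  open PermutationReasoning
  bs = fixedPattern π
  ls = nonFixedLetters π
  length-bs : length bs ≡ n
  length-bs = trans (LP.length-map isFixed (indexFrom 1 π)) (trans (length-indexFrom 1 π) (proj₁ (∈G⁻ {c} {n} π∈G)))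

-- Relabelling undoes the standardisation performed by dp.
insertFixed-fixedPattern-dp : ∀ {c n π} → π ∈ G c n → insertFixed (fixedPattern π) (dp π) ≡ π
insertFixed-fixedPattern-dp {c} {n} {π} π∈G =
  trans (cong (insertFixedFrom 1 bs) (trans (sym (LP.map-∘ ls)) (LP.map-id-local (All.tabulate relabel-standardise))))
        (insertFixedFrom-decomposition 1 π)
  where
  bs = fixedPattern π
  ls = nonFixedLetters π
  relabel-standardise : ∀ {l} → l ∈ ls → relabel bs (suc (count (λ m → proj₁ m <ᵇ proj₁ l) ls) , proj₂ l) ≡ l
  relabel-standardise {u , t} l∈ with ∈-nonFixedPositions⁻ 0 bs (PP.∈-resp-↭ (values-nonFixedLetters {c} {n} π∈G) (MP.∈-map⁺ proj₁ l∈))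
  ... | p , rest , refl , at = cong (_, t) (trans (cong (nthFalse bs ∘ suc) below) (nthFalse-at bs p at))
    where
    below : count (λ m → proj₁ m <ᵇ suc p) ls ≡ falsesBefore bs p
    below = trans (sym (count-map (_<ᵇ suc p) proj₁ ls))
                  (trans (count-↭ _ (values-nonFixedLetters {c} {n} π∈G)) (count-<-nonFixedPositions 0 bs p))

reverse-fixedPattern∈shuffles : ∀ {c n π} → π ∈ G c n →
  reverse (fixedPattern π) ∈ shuffles (n ∸ length (dp π)) (length (dp π))
reverse-fixedPattern∈shuffles {c} {n} {π} π∈G = ∈-shuffles⁺ _ _ (reverse bs) trues-reverse falses-reverse′
  where
  bs = fixedPattern π
  falses-reverse′ : falses (reverse bs) ≡ length (dp π)
  falses-reverse′ = trans (falses-reverse bs) (trans (falses-fixedPattern π) (sym (LP.length-map _ (nonFixedLetters π))))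
  length-bs : length bs ≡ n
  length-bs = trans (LP.length-map isFixed (indexFrom 1 π)) (trans (length-indexFrom 1 π) (proj₁ (∈G⁻ {c} {n} π∈G)))
  trues-reverse : trues (reverse bs) ≡ n ∸ length (dp π)
  trues-reverse = trans (sym (NP.m+n∸n≡m (trues (reverse bs)) (length (dp π))))
    (cong (_∸ length (dp π)) (trans (cong (_+_ (trues (reverse bs))) (sym falses-reverse′))
                                    (trans (trues+falses (reverse bs)) (trans (LP.length-reverse bs) length-bs))))

withDp-↭ : ∀ {c} n σ → 1 ≤ c → length σ ≤ n → IsDerangement c σ →
  withDp c n σ ↭ map (λ bs → insertFixed (reverse bs) σ) (shuffles (n ∸ length σ) (length σ))
withDp-↭ {c} n σ 1≤c k≤n der = ∼bag⇒↭ (unique∧set⇒bag unique-withDp unique-insertions (mk⇔ ⊆insertions ⊆withDp))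
  where
  k = length σ
  a = n ∸ k
  insert : List Bool → Word
  insert bs = insertFixed (reverse bs) σ
  module I {bs} (bs∈ : bs ∈ shuffles a k) = Insertion der (reverse bs) (trans (falses-reverse bs) (shuffles-falses a k bs∈))
  length-reverse : ∀ {bs} → bs ∈ shuffles a k → length (reverse bs) ≡ n
  length-reverse {bs} bs∈ = trans (LP.length-reverse bs) (trans (shuffles-length a k bs∈) (NP.m∸n+n≡m k≤n))
  unique-withDp : Unique (withDp c n σ)
  unique-withDp = UP.filter⁺ (λ π → dp π ≟W σ) (UP.filter⁺ (T? ∘ distinctVals) (allWords-unique n (letters c n) (letters-unique c n)))
  unique-insertions : Unique (map insert (shuffles a k))
  unique-insertions = Unique-map-injectiveOn insert (shuffles a k) (shuffles-unique a k) λ {bs} {bs′} bs∈ bs′∈ eq →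
    LP.reverse-injective (trans (sym (I.fixedPattern-insertFixed bs∈)) (trans (cong fixedPattern eq) (I.fixedPattern-insertFixed bs′∈)))
  ⊆insertions : ∀ {π} → π ∈ withDp c n σ → π ∈ map insert (shuffles a k)
  ⊆insertions {π} π∈ with MP.∈-filter⁻ (λ π → dp π ≟W σ) {xs = G c n} π∈
  ... | π∈G , refl = subst (_∈ map insert (shuffles a k))
                         (trans (cong (λ bs → insertFixed bs (dp π)) (LP.reverse-involutive (fixedPattern π))) (insertFixed-fixedPattern-dp {c} {n} π∈G))
                         (MP.∈-map⁺ insert (reverse-fixedPattern∈shuffles {c} π∈G))
  ⊆withDp : ∀ {π} → π ∈ map insert (shuffles a k) → π ∈ withDp c n σ
  ⊆withDp π∈ with MP.∈-map⁻ insert π∈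
  ... | bs , bs∈ , refl = MP.∈-filter⁺ (λ π → dp π ≟W σ) (I.insertFixed∈G bs∈ 1≤c (length-reverse bs∈)) (I.dp-insertFixed bs∈)

T-not⇒≡false : ∀ {b} → T (not b) → b ≡ false
T-not⇒≡false {false} _ = refl

any≡false⇒All : {A : Set} (p : A → Bool) (xs : List A) → any p xs ≡ false → All (λ x → p x ≡ false) xs
any≡false⇒All p []       _    = []
any≡false⇒All p (x ∷ xs) none with p x in px
... | false = px ∷ any≡false⇒All p xs none

D⇒IsDerangement : ∀ c k σ → σ ∈ D c k → length σ ≡ k × IsDerangement c σ
D⇒IsDerangement c k σ σ∈D with MP.∈-filter⁻ (T? ∘ (not ∘ hasFixedPoint)) {xs = G c k} σ∈D
... | σ∈G , no-fixed-point with ∈G⁻ {c} {k} σ∈G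
...   | refl , σ⊆letters , permutes = refl , record
  { values   = All.map (λ l∈ → let (1≤v , v≤k , _) = letters-∈⁻ c (length σ) l∈ in 1≤v , v≤k) σ⊆letters
  ; colours  = All.map (λ l∈ → proj₂ (proj₂ (letters-∈⁻ c (length σ) l∈))) σ⊆letters
  ; permutes = permutes
  ; noFixed  = any≡false⇒All isFixed (indexFrom 1 σ) (T-not⇒≡false no-fixed-point)
  }

-- The signed sum

weight : ℕ → ℤ → Word → ℤ
weight c q π = (- (+ 1)) ^ℤ L c π *ℤ q ^ℤ fmaj c π

signedSum≡sumℤ : ∀ c q ws → signedSum c q ws ≡ sumℤ (map (weight c q) ws)
signedSum≡sumℤ c q []       = refl
signedSum≡sumℤ c q (π ∷ ws) = cong (weight c q π +ℤ_) (signedSum≡sumℤ c q ws)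

-1^-+-even : ∀ a t → (- (+ 1)) ^ℤ (a + 2 * t) ≡ (- (+ 1)) ^ℤ a
-1^-+-even a t = begin
  (- (+ 1)) ^ℤ (a + 2 * t)               ≡⟨ ZP.^-distribˡ-+-* (- (+ 1)) a (2 * t) ⟩
  (- (+ 1)) ^ℤ a *ℤ (- (+ 1)) ^ℤ (2 * t) ≡⟨ cong ((- (+ 1)) ^ℤ a *ℤ_) (sym (ZP.^-*-assoc (- (+ 1)) 2 t)) ⟩
  (- (+ 1)) ^ℤ a *ℤ (+ 1) ^ℤ t           ≡⟨ cong ((- (+ 1)) ^ℤ a *ℤ_) (ZP.^-zeroˡ t) ⟩
  (- (+ 1)) ^ℤ a *ℤ + 1                  ≡⟨ ZP.*-identityʳ _ ⟩
  (- (+ 1)) ^ℤ a                         ∎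
  where open ≡-Reasoning

q^fmaj : ∀ c q π → q ^ℤ fmaj c π ≡ (q ^ℤ c) ^ℤ maj π *ℤ q ^ℤ col π
q^fmaj c q π = trans (ZP.^-distribˡ-+-* q (c * maj π) (col π)) (cong (_*ℤ q ^ℤ col π) (sym (ZP.^-*-assoc q c (maj π))))

-- For even c the sign of π only depends on col π and the parity of inv π, both of which
-- inserting fixed points preserves.
weight-insertFixed : ∀ {c m} → c ≡ m * 2 → ∀ q {σ} → IsDerangement c σ → ∀ bs → falses bs ≡ length σ →
  weight c q (insertFixed bs σ) ≡ (- (+ 1)) ^ℤ L c σ *ℤ q ^ℤ col σ *ℤ (q ^ℤ c) ^ℤ maj (insertFixed bs σ)
weight-insertFixed {c} {m} c≡2m q {σ} der bs len = begin
  (- (+ 1)) ^ℤ L c π *ℤ q ^ℤ fmaj c π                        ≡⟨ cong₂ _*ℤ_ sign (q^fmaj c q π) ⟩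
  (- (+ 1)) ^ℤ L c σ *ℤ ((q ^ℤ c) ^ℤ maj π *ℤ q ^ℤ col π)     ≡⟨ cong (λ n → (- (+ 1)) ^ℤ L c σ *ℤ ((q ^ℤ c) ^ℤ maj π *ℤ q ^ℤ n)) col-insertFixed ⟩
  (- (+ 1)) ^ℤ L c σ *ℤ ((q ^ℤ c) ^ℤ maj π *ℤ q ^ℤ col σ)     ≡⟨ swap ((- (+ 1)) ^ℤ L c σ) ((q ^ℤ c) ^ℤ maj π) (q ^ℤ col σ) ⟩
  (- (+ 1)) ^ℤ L c σ *ℤ q ^ℤ col σ *ℤ (q ^ℤ c) ^ℤ maj π       ∎
  where
  open ≡-Reasoning
  open Insertion der bs len
  π = insertFixed bs σ
  X = invFixedLetter 1 bs w
  swap : ∀ s y z → s *ℤ (y *ℤ z) ≡ s *ℤ z *ℤ y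
  swap = solve-∀
  L-even : ∀ τ → L c τ ≡ col τ + inv τ + 2 * (m * colAsc [] τ)
  L-even τ = trans (cong (λ d → col τ + d * colAsc [] τ + inv τ) c≡2m) (rearrange (col τ) m (colAsc [] τ) (inv τ))
    where
    rearrange : ∀ a m y i → a + m * 2 * y + i ≡ a + i + 2 * (m * y)
    rearrange = ℕ-solve-∀
  sign : (- (+ 1)) ^ℤ L c π ≡ (- (+ 1)) ^ℤ L c σ
  sign = begin
    (- (+ 1)) ^ℤ L c π                                          ≡⟨ cong ((- (+ 1)) ^ℤ_) (L-even π) ⟩
    (- (+ 1)) ^ℤ (col π + inv π + 2 * (m * colAsc [] π))         ≡⟨ -1^-+-even (col π + inv π) (m * colAsc [] π) ⟩
    (- (+ 1)) ^ℤ (col π + inv π)                                ≡⟨ cong₂ (λ a i → (- (+ 1)) ^ℤ (a + i)) col-insertFixed inv-insertFixed ⟩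
    (- (+ 1)) ^ℤ (col σ + (inv σ + 2 * X))                      ≡⟨ cong ((- (+ 1)) ^ℤ_) (sym (NP.+-assoc (col σ) (inv σ) _)) ⟩
    (- (+ 1)) ^ℤ (col σ + inv σ + 2 * X)                        ≡⟨ -1^-+-even (col σ + inv σ) X ⟩
    (- (+ 1)) ^ℤ (col σ + inv σ)                                ≡⟨ sym (-1^-+-even (col σ + inv σ) (m * colAsc [] σ)) ⟩
    (- (+ 1)) ^ℤ (col σ + inv σ + 2 * (m * colAsc [] σ))         ≡⟨ cong ((- (+ 1)) ^ℤ_) (sym (L-even σ)) ⟩
    (- (+ 1)) ^ℤ L c σ                                          ∎

signedSum-withDp : ∀ {c m} → c ≡ m * 2 → 1 ≤ c → ∀ n q σ → length σ ≤ n → IsDerangement c σ →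
  signedSum c q (withDp c n σ)
    ≡ (- (+ 1)) ^ℤ L c σ *ℤ q ^ℤ col σ *ℤ ((q ^ℤ c) ^ℤ maj σ *ℤ qBinom (q ^ℤ c) (n ∸ length σ) (length σ))
signedSum-withDp {c} {m} c≡2m 1≤c n q σ k≤n der = begin
  signedSum c q (withDp c n σ)                        ≡⟨ signedSum≡sumℤ c q (withDp c n σ) ⟩
  sumℤ (map (weight c q) (withDp c n σ))              ≡⟨ sumℤ-↭ (PP.map⁺ (weight c q) (withDp-↭ n σ 1≤c k≤n der)) ⟩
  sumℤ (map (weight c q) (map insert (shuffles a k)))  ≡⟨ cong sumℤ (sym (LP.map-∘ (shuffles a k))) ⟩
  sumℤ (map (weight c q ∘ insert) (shuffles a k))     ≡⟨ sumℤ-map-cong (shuffles a k) (λ {bs} bs∈ →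
                                                          weight-insertFixed {m = m} c≡2m q der (reverse bs) (trans (falses-reverse bs) (shuffles-falses a k bs∈))) ⟩
  sumℤ (map (λ bs → S *ℤ x ^ℤ maj (insert bs)) (shuffles a k))   ≡⟨ sumℤ-map-*ˡ S (λ bs → x ^ℤ maj (insert bs)) (shuffles a k) ⟩
  S *ℤ sumℤ (map (λ bs → x ^ℤ maj (insert bs)) (shuffles a k))   ≡⟨ cong (S *ℤ_) (sum-maj-insertFixed x a σ values noFixed) ⟩
  S *ℤ (x ^ℤ maj σ *ℤ qBinom x a k)                              ∎
  where
  open ≡-Reasoning
  open IsDerangement der
  k = length σ
  a = n ∸ k
  x = q ^ℤ c
  S = (- (+ 1)) ^ℤ L c σ *ℤ q ^ℤ col σ
  insert : List Bool → Word
  insert bs = insertFixed (reverse bs) σ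

proposition2p10 : (c : ℕ) → 2 ∣ c → 1 ≤ c → (k n : ℕ) → k ≤ n → (σ : Word) → σ ∈ D c k →
    (q : ℤ) →
    signedSum c q (withDp c n σ) *ℤ qFact (q ^ℤ c) k *ℤ qFact (q ^ℤ c) (n ∸ k)
      ≡ ((- (+ 1)) ^ℤ L c σ) *ℤ (q ^ℤ fmaj c σ) *ℤ qFact (q ^ℤ c) n
proposition2p10 c (divides m c≡2m) 1≤c k n k≤n σ σ∈D q with D⇒IsDerangement c k σ σ∈D
... | refl , der = begin
  signedSum c q (withDp c n σ) *ℤ qFact x k *ℤ qFact x (n ∸ k)
    ≡⟨ cong (λ s → s *ℤ qFact x k *ℤ qFact x (n ∸ k)) (signedSum-withDp {m = m} c≡2m 1≤c n q σ k≤n der) ⟩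
  sign *ℤ q ^ℤ col σ *ℤ (x ^ℤ maj σ *ℤ qBinom x (n ∸ k) k) *ℤ qFact x k *ℤ qFact x (n ∸ k)
    ≡⟨ regroup sign (q ^ℤ col σ) (x ^ℤ maj σ) (qBinom x (n ∸ k) k) (qFact x k) (qFact x (n ∸ k)) ⟩
  sign *ℤ (x ^ℤ maj σ *ℤ q ^ℤ col σ) *ℤ (qBinom x (n ∸ k) k *ℤ qFact x (n ∸ k) *ℤ qFact x k)
    ≡⟨ cong₂ (λ y z → sign *ℤ y *ℤ z) (sym (q^fmaj c q σ)) (qBinom-qFact x (n ∸ k) k) ⟩
  sign *ℤ q ^ℤ fmaj c σ *ℤ qFact x (n ∸ k + k)
    ≡⟨ cong (λ n′ → sign *ℤ q ^ℤ fmaj c σ *ℤ qFact x n′) (NP.m∸n+n≡m k≤n) ⟩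
  sign *ℤ q ^ℤ fmaj c σ *ℤ qFact x n ∎
  where
  open ≡-Reasoning
  x = q ^ℤ c
  sign = (- (+ 1)) ^ℤ L c σ
  regroup : ∀ s y z b f g → s *ℤ y *ℤ (z *ℤ b) *ℤ f *ℤ g ≡ s *ℤ (z *ℤ y) *ℤ (b *ℤ g *ℤ f)
  regroup = solve-∀
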